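{- Let $\Gamma$ be the linear cellular automaton over $(\mathbb{Z}/2\mathbb{Z})^3$ given by the matrix $\Gamma=\begin{pmatrix}0&0&1\\0&1&u\\1&u&0\end{pmatrix}\in\mathscr{M}_3(\mathbb{Z}/2\mathbb{Z})[u,u^{ -1}]$. Then $\overline{X_2(\Gamma)}$ contains the segment joining $(0,1)$ and $(\tfrac{2}{3},\tfrac{2}{3})$.
   Context: Linear CA: a matrix $M=\sum_k M_k u^k\in\mathscr{M}_d(R)[u,u^{ -1}]$ ($R$ a finite commutative ring) defines the CA on $(R^d)^{\mathbb{Z}}$ given by $(Mc)(x)=\sum_k M_k\,c(x-k)$ (configurations viewed as series $\sum_x c(x)u^x$ and multiplied by $M$). For a CA $H$ with state set $C$, $c\in C^{\mathbb{Z}}$, $q\in C$, $\phi_c(q)$ is the configuration equal to $q$ at position $0$ and to $c(z)$ at $z\neq0$; $H^y_{x,c}:C\to C$ is $q\mapsto (H^y(\phi_c(q)))_x$. $H$ has property $P(x,y,l,r)$ ($x\in\mathbb{Z}$; $y,l,r\in\mathbb{N}$) if $H^y_{x,c}$ is a bijection for all $c$ and $H^y_{z,c}$ is constant for all $c$ and all integers $z\in[x-l,x+r]\setminus\{x\}$. For an integer $p\geq2$, $X_p(H)$ is the set of $(x,y)\in\mathbb{R}\times[0,+\infty)$ such that for some $k\in\mathbb{N}$, for every large enough $n$, $H$ has property $P(xp^n,yp^n,p^{n-k},p^{n-k})$; $\overline{X_p(H)}$ is its topological closure in $\mathbb{R}^2$.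
   Formalization: Only the points of the segment joining (0,1) and (2/3,2/3) that have rational coordinates are shown to lie in $\overline{X_2(\Gamma)}$. -}

module Defs where

open import Data.Bool using (Bool; true; false; _xor_; _∧_; if_then_else_)
open import Data.Nat as ℕ using (ℕ; zero; suc; _∸_; _^_)
open import Data.Integer as ℤ using (ℤ; +_; -_)
open import Data.Rational as ℚ using (ℚ; 0ℚ; 1ℚ)
open import Data.Vec using (Vec; []; _∷_; zipWith; replicate; map; foldr)
open import Data.List as L using (List; []; _∷_)
open import Data.Product using (Σ; _×_; _,_; ∃; ∃-syntax)
open import Relation.Binary.PropositionalEquality using (_≡_; _≢_)
open import Relation.Nullary.Decidable using (does)
open import Function using (_∘_)
open import Function.Definitions using (Bijective)

-- Linear CA over (Z/2Z)^d.  Z/2Z is Bool with xor (+) and ∧ (·).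

State : ℕ → Set
State d = Vec Bool d

-- a d×d matrix over Z/2Z, as a vector of rows
Matrix : ℕ → Set
Matrix d = Vec (Vec Bool d) d

Config : ℕ → Set
Config d = ℤ → State d

𝟘 : ∀ {d} → State d
𝟘 = replicate _ false

_⊕_ : ∀ {d} → State d → State d → State d
_⊕_ = zipWith _xor_

dot : ∀ {d} → Vec Bool d → Vec Bool d → Bool
dot u v = foldr _ _xor_ false (zipWith _∧_ u v)

_·_ : ∀ {d} → Matrix d → State d → State d
M · v = map (λ row → dot row v) M

-- A Laurent matrix  M = Σ_k M_k u^k  given as a finite list of (k , M_k)
LaurentMatrix : ℕ → Set
LaurentMatrix d = List (ℤ × Matrix d)

linCA : ∀ {d} → LaurentMatrix d → Config d → Config d
linCA [] c x = 𝟘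
linCA ((k , Mk) ∷ Ms) c x = (Mk · c (x ℤ.- k)) ⊕ linCA Ms c x

iter : ∀ {A : Set} → ℕ → (A → A) → A → A
iter zero    H a = a
iter (suc y) H a = H (iter y H a)

φ : ∀ {d} → Config d → State d → Config d
φ c q z = if does (z ℤ.≟ + 0) then q else c z

local : ∀ {d} → (Config d → Config d) → ℕ → ℤ → Config d → State d → State d
local H y x c q = iter y H (φ c q) x

P : ∀ {d} → (Config d → Config d) → ℤ → ℕ → ℕ → ℕ → Set
P {d} H x y l r =
  ((c : Config d) → Bijective _≡_ _≡_ (local H y x c))
  × ((c : Config d) (z : ℤ) → x ℤ.- + l ℤ.≤ z → z ℤ.≤ x ℤ.+ + r → z ≢ x →
       (q q′ : State d) → local H y z c q ≡ local H y z c q′)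

-- X_p(H), for points (x , y) with rational coordinates.
-- (Every point of X_p(H) has x p^n ∈ ℤ and y p^n ∈ ℕ for some n, so
--  X_p(H) ⊆ ℚ × ℚ≥0 and nothing is lost by restricting to ℚ.)

toℚ : ℤ → ℚ
toℚ z = z ℚ./ 1

X : ∀ {d} → (Config d → Config d) → (p : ℕ) → ℚ → ℚ → Set
X H p x y =
  ∃[ k ] ∃[ N ] ∀ n → N ℕ.≤ n →
    ∃[ a ] ∃[ b ]
      (toℚ a ≡ x ℚ.* toℚ (+ (p ^ n)))
      × (toℚ (+ b) ≡ y ℚ.* toℚ (+ (p ^ n)))
      × P H a b (p ^ (n ∸ k)) (p ^ (n ∸ k))

-- (x , y) lies in the topological closure of X_p(H) in ℝ² (tested with the
-- sup-distance and rational ε, which gives the same topology)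
InClosureX : ∀ {d} → (Config d → Config d) → (p : ℕ) → ℚ → ℚ → Set
InClosureX H p x y =
  (ε : ℚ) → 0ℚ ℚ.< ε →
    ∃[ x′ ] ∃[ y′ ] X H p x′ y′
      × ℚ.∣ x′ ℚ.- x ∣ ℚ.< ε × ℚ.∣ y′ ℚ.- y ∣ ℚ.< ε

-- The automaton Γ = [[0,0,1],[0,1,u],[1,u,0]] = M₀ + M₁ u

Γ₀ : Matrix 3
Γ₀ = (false ∷ false ∷ true ∷ [])
   ∷ (false ∷ true ∷ false ∷ [])
   ∷ (true ∷ false ∷ false ∷ [])
   ∷ []

Γ₁ : Matrix 3
Γ₁ = (false ∷ false ∷ false ∷ [])
   ∷ (false ∷ false ∷ true ∷ [])
   ∷ (false ∷ true ∷ false ∷ [])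
   ∷ []

ΓMat : LaurentMatrix 3
ΓMat = (+ 0 , Γ₀) ∷ (+ 1 , Γ₁) ∷ []

Γ : Config 3 → Config 3
Γ = linCA ΓMat

-- Over 𝔽₂ the automaton Γ is invertible, Γ⁻¹ = [[u², u, 1], [u, 1, 0], [1, 0, 0]], and Γ = 𝟙 + E where E³
-- only involves powers u^k with k ≥ 2. In characteristic 2, Γ^(2^M) = 𝟙 + E^(2^M), and E^(2^M) reads no
-- offset below 2⌊2^M/3⌋. Composing with Γ^-(4+8j) = u^(16j)(𝟙 + D) + Rⱼ, where D reads the offsets 2..8
-- and Rⱼ the offsets 0..16j-4 (finite computations on Γ^-4, Γ^-8, Γ^-12, then induction on j), gives
-- Γ^(2^M-4-8j) = u^(16j) + R with R blind to the offsets 16j-1, 16j, 16j+1 whenever 16j+2 ≤ 2⌊2^M/3⌋: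
-- this is property P at (16j, 2^M-4-8j) with radius 1. The conjugation Γ²Π = ΠΓ(u²) doubles position,
-- time and radius of such a decomposition, so (16j/2^M, 1 - (4+8j)/2^M) lies in X₂(Γ); choosing
-- 8j ≈ t(⌊2^M/3⌋ - 1) these points tend to (2t/3, 1 - t/3).

module Submission where

open import Defs
open import Data.Bool using (Bool; true; false; _xor_; _∧_)
open import Data.Bool.Properties as Boolₚ
  using (xor-∧-commutativeRing; xor-comm; xor-assoc; xor-same; xor-identityʳ; ∧-zeroʳ)
open import Data.Maybe using (Maybe; just; nothing)
open import Data.Nat as ℕ using (ℕ; zero; suc)
import Data.Nat.Properties as ℕₚ
import Data.Nat.DivMod as ℕDivMod
open import Data.Nat.Coprimality using (Coprime)
open import Data.Integer as ℤ using (ℤ; +_; -[1+_])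
import Data.Integer.Properties as ℤₚ
import Data.Integer.DivMod as ℤDivMod
open import Data.Rational as ℚ using (ℚ; mkℚ; toℚᵘ; 0ℚ; 1ℚ; _≤_; _+_; _-_; _*_; _/_)
import Data.Rational.Properties as ℚₚ
open import Data.Rational.Unnormalised as ℚᵘ using (mkℚᵘ; *≡*; *<*)
import Data.Rational.Unnormalised.Properties as ℚᵘₚ
open import Data.Product using (Σ; _×_; _,_; proj₁; proj₂; ∃-syntax)
open import Data.Sum using (_⊎_; inj₁; inj₂)
open import Data.List as List using (List; []; _∷_; _++_)
open import Data.List.Membership.Propositional using (_∈_)
open import Data.List.Relation.Unary.All as All using (All)
open import Data.List.Relation.Unary.Any using (here; there)
open import Data.Vec using (Vec; []; _∷_; map; zipWith; replicate)
import Data.Vec.Properties as Vecₚ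
open import Function using (_∘_; _$_)
open import Function.Definitions using (Bijective)
open import Relation.Binary.PropositionalEquality
open import Relation.Nullary using (Dec; yes; no; ¬_; contradiction)
open import Relation.Nullary.Decidable using (_×-dec_; from-yes)
open import Tactic.RingSolver using (solve-∀)
open import Tactic.RingSolver.Core.AlmostCommutativeRing using (AlmostCommutativeRing; fromCommutativeRing)
open import Data.Integer.Tactic.RingSolver using () renaming (solve-∀ to ℤsolve-∀)
open import Data.Nat.Tactic.RingSolver using () renaming (solve-∀ to ℕsolve-∀)

-- Vectors and matrices over 𝔽₂

𝔽₂ : AlmostCommutativeRing _ _
𝔽₂ = fromCommutativeRing xor-∧-commutativeRing isZero
  where
  isZero : ∀ b → Maybe (false ≡ b)
  isZero false = just refl
  isZero true  = nothing

⊕-comm : ∀ {d} (v w : State d) → v ⊕ w ≡ w ⊕ v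
⊕-comm []      []      = refl
⊕-comm (a ∷ v) (b ∷ w) = cong₂ _∷_ (xor-comm a b) (⊕-comm v w)

⊕-assoc : ∀ {d} (u v w : State d) → (u ⊕ v) ⊕ w ≡ u ⊕ (v ⊕ w)
⊕-assoc []      []      []      = refl
⊕-assoc (a ∷ u) (b ∷ v) (c ∷ w) = cong₂ _∷_ (xor-assoc a b c) (⊕-assoc u v w)

⊕-identityˡ : ∀ {d} (v : State d) → 𝟘 ⊕ v ≡ v
⊕-identityˡ []      = refl
⊕-identityˡ (a ∷ v) = cong (a ∷_) (⊕-identityˡ v)

⊕-identityʳ : ∀ {d} (v : State d) → v ⊕ 𝟘 ≡ v
⊕-identityʳ v = trans (⊕-comm v 𝟘) (⊕-identityˡ v)

⊕-self : ∀ {d} (v : State d) → v ⊕ v ≡ 𝟘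
⊕-self []      = refl
⊕-self (a ∷ v) = cong₂ _∷_ (xor-same a) (⊕-self v)

⊕-cancelˡ : ∀ {d} (v w : State d) → v ⊕ (v ⊕ w) ≡ w
⊕-cancelˡ v w = begin
  v ⊕ (v ⊕ w)  ≡⟨ ⊕-assoc v v w ⟨
  (v ⊕ v) ⊕ w  ≡⟨ cong (_⊕ w) (⊕-self v) ⟩
  𝟘 ⊕ w        ≡⟨ ⊕-identityˡ w ⟩
  w            ∎
  where open ≡-Reasoning

⊕-cancelʳ : ∀ {d} (v w : State d) → (v ⊕ w) ⊕ w ≡ v
⊕-cancelʳ v w = trans (⊕-comm (v ⊕ w) w) (trans (cong (w ⊕_) (⊕-comm v w)) (⊕-cancelˡ w v))

⊕-interchange : ∀ {d} (u v w z : State d) → (u ⊕ v) ⊕ (w ⊕ z) ≡ (u ⊕ w) ⊕ (v ⊕ z)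
⊕-interchange u v w z = begin
  (u ⊕ v) ⊕ (w ⊕ z)  ≡⟨ ⊕-assoc u v (w ⊕ z) ⟩
  u ⊕ (v ⊕ (w ⊕ z))  ≡⟨ cong (u ⊕_) (⊕-assoc v w z) ⟨
  u ⊕ ((v ⊕ w) ⊕ z)  ≡⟨ cong (λ s → u ⊕ (s ⊕ z)) (⊕-comm v w) ⟩
  u ⊕ ((w ⊕ v) ⊕ z)  ≡⟨ cong (u ⊕_) (⊕-assoc w v z) ⟩
  u ⊕ (w ⊕ (v ⊕ z))  ≡⟨ ⊕-assoc u w (v ⊕ z) ⟨
  (u ⊕ w) ⊕ (v ⊕ z)  ∎
  where open ≡-Reasoning

⊕-zero⇒≡ : ∀ {d} (v w : State d) → v ⊕ w ≡ 𝟘 → v ≡ w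
⊕-zero⇒≡ v w v⊕w≡𝟘 = trans (sym (⊕-cancelʳ v w)) (trans (cong (_⊕ w) v⊕w≡𝟘) (⊕-identityˡ w))

_⊗_ : ∀ {d} → Bool → State d → State d
a ⊗ v = map (a ∧_) v

dot-⊕ʳ : ∀ {d} (r v w : State d) → dot r (v ⊕ w) ≡ dot r v xor dot r w
dot-⊕ʳ []      []      []      = refl
dot-⊕ʳ (a ∷ r) (x ∷ v) (y ∷ w) =
  trans (cong ((a ∧ (x xor y)) xor_) (dot-⊕ʳ r v w)) (expand a x y (dot r v) (dot r w))
  where
  expand : ∀ a x y p q → (a ∧ (x xor y)) xor (p xor q) ≡ ((a ∧ x) xor p) xor ((a ∧ y) xor q)
  expand = solve-∀ 𝔽₂

dot-⊕ˡ : ∀ {d} (r s v : State d) → dot (r ⊕ s) v ≡ dot r v xor dot s v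
dot-⊕ˡ []      []      []      = refl
dot-⊕ˡ (a ∷ r) (b ∷ s) (x ∷ v) =
  trans (cong (((a xor b) ∧ x) xor_) (dot-⊕ˡ r s v)) (expand a b x (dot r v) (dot s v))
  where
  expand : ∀ a b x p q → ((a xor b) ∧ x) xor (p xor q) ≡ ((a ∧ x) xor p) xor ((b ∧ x) xor q)
  expand = solve-∀ 𝔽₂

dot-⊗ˡ : ∀ {d} (a : Bool) (r v : State d) → dot (a ⊗ r) v ≡ a ∧ dot r v
dot-⊗ˡ a []      []      = sym (∧-zeroʳ a)
dot-⊗ˡ a (b ∷ r) (x ∷ v) =
  trans (cong (((a ∧ b) ∧ x) xor_) (dot-⊗ˡ a r v)) (expand a b x (dot r v))
  where
  expand : ∀ a b x p → ((a ∧ b) ∧ x) xor (a ∧ p) ≡ a ∧ ((b ∧ x) xor p)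
  expand = solve-∀ 𝔽₂

dot-𝟘ˡ : ∀ {d} (v : State d) → dot 𝟘 v ≡ false
dot-𝟘ˡ []      = refl
dot-𝟘ˡ (x ∷ v) = dot-𝟘ˡ v

dot-𝟘ʳ : ∀ {d} (r : State d) → dot r 𝟘 ≡ false
dot-𝟘ʳ r = trans (cong (dot r) (sym (⊕-self 𝟘))) (trans (dot-⊕ʳ r 𝟘 𝟘) (xor-same (dot r 𝟘)))

_+ᴹ_ : ∀ {d} → Matrix d → Matrix d → Matrix d
_+ᴹ_ = zipWith _⊕_

𝟘ᴹ : ∀ {d} → Matrix d
𝟘ᴹ = replicate _ 𝟘

𝟙ᴹ : ∀ {d} → Matrix d
𝟙ᴹ {zero}  = []
𝟙ᴹ {suc d} = (true ∷ 𝟘) ∷ map (false ∷_) 𝟙ᴹ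

combination : ∀ {m d} → Vec Bool m → Vec (State d) m → State d
combination []      []      = 𝟘
combination (a ∷ r) (v ∷ N) = (a ⊗ v) ⊕ combination r N

_*ᴹ_ : ∀ {d} → Matrix d → Matrix d → Matrix d
M *ᴹ N = map (λ r → combination r N) M

dot-combination : ∀ {m d} (r : Vec Bool m) (N : Vec (State d) m) (v : State d) →
  dot (combination r N) v ≡ dot r (map (λ n → dot n v) N)
dot-combination []      []      v = dot-𝟘ˡ v
dot-combination (a ∷ r) (n ∷ N) v = begin
  dot ((a ⊗ n) ⊕ combination r N) v                ≡⟨ dot-⊕ˡ (a ⊗ n) (combination r N) v ⟩
  dot (a ⊗ n) v xor dot (combination r N) v        ≡⟨ cong₂ _xor_ (dot-⊗ˡ a n v) (dot-combination r N v) ⟩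
  (a ∧ dot n v) xor dot r (map (λ n → dot n v) N)  ∎
  where open ≡-Reasoning

module _ {d : ℕ} where

  private
    rows-⊕ʳ : ∀ {m} (M : Vec (State d) m) v w →
      map (λ r → dot r (v ⊕ w)) M ≡ map (λ r → dot r v) M ⊕ map (λ r → dot r w) M
    rows-⊕ʳ []      v w = refl
    rows-⊕ʳ (r ∷ M) v w = cong₂ _∷_ (dot-⊕ʳ r v w) (rows-⊕ʳ M v w)

    rows-⊕ˡ : ∀ {m} (M N : Vec (State d) m) v →
      map (λ r → dot r v) (zipWith _⊕_ M N) ≡ map (λ r → dot r v) M ⊕ map (λ r → dot r v) N
    rows-⊕ˡ []      []      v = refl
    rows-⊕ˡ (r ∷ M) (s ∷ N) v = cong₂ _∷_ (dot-⊕ˡ r s v) (rows-⊕ˡ M N v)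

    rows-𝟘ˡ : ∀ {m} (v : State d) → map (λ r → dot r v) (replicate m (𝟘 {d})) ≡ 𝟘
    rows-𝟘ˡ {zero}  v = refl
    rows-𝟘ˡ {suc m} v = cong₂ _∷_ (dot-𝟘ˡ v) (rows-𝟘ˡ v)

    rows-𝟘ʳ : ∀ {m} (M : Vec (State d) m) → map (λ r → dot r 𝟘) M ≡ 𝟘
    rows-𝟘ʳ []      = refl
    rows-𝟘ʳ (r ∷ M) = cong₂ _∷_ (dot-𝟘ʳ r) (rows-𝟘ʳ M)

  ·-⊕ : (M : Matrix d) (v w : State d) → M · (v ⊕ w) ≡ (M · v) ⊕ (M · w)
  ·-⊕ = rows-⊕ʳ

  ·-𝟘 : (M : Matrix d) → M · 𝟘 ≡ 𝟘
  ·-𝟘 = rows-𝟘ʳ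

  +ᴹ-· : (M N : Matrix d) (v : State d) → (M +ᴹ N) · v ≡ (M · v) ⊕ (N · v)
  +ᴹ-· = rows-⊕ˡ

  𝟘ᴹ-· : (v : State d) → 𝟘ᴹ · v ≡ 𝟘
  𝟘ᴹ-· = rows-𝟘ˡ

  *ᴹ-· : (M N : Matrix d) (v : State d) → (M *ᴹ N) · v ≡ M · (N · v)
  *ᴹ-· M N v = trans (sym (Vecₚ.map-∘ (λ r → dot r v) (λ r → combination r N) M))
                     (Vecₚ.map-cong (λ r → dot-combination r N v) M)

𝟙ᴹ-· : ∀ {d} (v : State d) → 𝟙ᴹ · v ≡ v
𝟙ᴹ-· []      = refl
𝟙ᴹ-· (x ∷ v) = cong₂ _∷_ (trans (cong (x xor_) (dot-𝟘ˡ v)) (xor-identityʳ x))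
  (trans (sym (Vecₚ.map-∘ (λ r → dot r (x ∷ v)) (false ∷_) 𝟙ᴹ)) (𝟙ᴹ-· v))

-- Operators on configurations and the cells they read

Op : ℕ → Set
Op d = Config d → Config d

_⊕ᶜ_ : ∀ {d} → Config d → Config d → Config d
(c ⊕ᶜ c′) x = c x ⊕ c′ x

shift : ∀ {d} → ℤ → Op d
shift k c x = c (x ℤ.- k)

Extensional : ∀ {d} → Op d → Set
Extensional H = ∀ {c c′} → c ≗ c′ → H c ≗ H c′

Additive : ∀ {d} → Op d → Set
Additive H = ∀ c c′ → H (c ⊕ᶜ c′) ≗ H c ⊕ᶜ H c′

DependsOn : ∀ {d} → Op d → (ℤ → Set) → Set
DependsOn H S = ∀ c c′ x → (∀ k → S k → c (x ℤ.- k) ≡ c′ (x ℤ.- k)) → H c x ≡ H c′ x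

_+ˢ_ : (ℤ → Set) → (ℤ → Set) → ℤ → Set
(S +ˢ T) k = ∃[ i ] ∃[ j ] S i × T j × k ≡ i ℤ.+ j

Within : ℤ → ℤ → ℤ → Set
Within lo hi k = lo ℤ.≤ k × k ℤ.≤ hi

within? : ∀ lo hi k → Dec (Within lo hi k)
within? lo hi k = lo ℤ.≤? k ×-dec k ℤ.≤? hi

private
  sub-sub : ∀ x i j → x ℤ.- (i ℤ.+ j) ≡ (x ℤ.- i) ℤ.- j
  sub-sub = ℤsolve-∀

module _ {d : ℕ} where

  DependsOn-mono : ∀ {H : Op d} {S T} → (∀ {k} → S k → T k) → DependsOn H S → DependsOn H T
  DependsOn-mono S⊆T H-S c c′ x agree = H-S c c′ x (λ k s → agree k (S⊆T s))

  DependsOn⇒Extensional : ∀ {H : Op d} {S} → DependsOn H S → Extensional H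
  DependsOn⇒Extensional H-S c≗c′ x = H-S _ _ x (λ k _ → c≗c′ (x ℤ.- k))

  DependsOn-∘ : ∀ {A B : Op d} {S T} → DependsOn A S → DependsOn B T → DependsOn (A ∘ B) (S +ˢ T)
  DependsOn-∘ {B = B} A-S B-T c c′ x agree =
    A-S (B c) (B c′) x λ i si → B-T c c′ (x ℤ.- i) λ j tj →
      subst (λ y → c y ≡ c′ y) (sub-sub x i j) (agree (i ℤ.+ j) (i , j , si , tj , refl))

  DependsOn-⊕ᶜ : ∀ {A B : Op d} {S T} → DependsOn A S → DependsOn B T →
    DependsOn (λ c → A c ⊕ᶜ B c) (λ k → S k ⊎ T k)
  DependsOn-⊕ᶜ A-S B-T c c′ x agree =
    cong₂ _⊕_ (A-S c c′ x (λ k s → agree k (inj₁ s))) (B-T c c′ x (λ k t → agree k (inj₂ t)))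

  shift-dependsOn : ∀ a → DependsOn (shift {d} a) (_≡ a)
  shift-dependsOn a c c′ x agree = agree a refl

DependsOn-≗ : ∀ {d} {A B : Op d} {S} → (∀ c → A c ≗ B c) → DependsOn B S → DependsOn A S
DependsOn-≗ A≗B B-S c c′ x agree = trans (A≗B c x) (trans (B-S c c′ x agree) (sym (A≗B c′ x)))

iter-extensional : ∀ {d} {H : Op d} → Extensional H → ∀ n → Extensional (iter n H)
iter-extensional H-ext zero    c≗c′ = c≗c′
iter-extensional H-ext (suc n) c≗c′ = H-ext (iter-extensional H-ext n c≗c′)

iter-additive : ∀ {d} {H : Op d} → Extensional H → Additive H → ∀ n → Additive (iter n H)
iter-additive H-ext H-add zero    c c′ x = refl
iter-additive H-ext H-add (suc n) c c′ x =
  trans (H-ext (iter-additive H-ext H-add n c c′) x) (H-add _ _ x)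

iter-+ : ∀ {A : Set} (H : A → A) m n a → iter (m ℕ.+ n) H a ≡ iter m H (iter n H a)
iter-+ H zero    n a = refl
iter-+ H (suc m) n a = cong H (iter-+ H m n a)

iter-suc : ∀ {A : Set} (H : A → A) n a → iter (suc n) H a ≡ iter n H (H a)
iter-suc H zero    a = refl
iter-suc H (suc n) a = cong H (iter-suc H n a)

iter-* : ∀ {A : Set} (H : A → A) m n a → iter (m ℕ.* n) H a ≡ iter m (iter n H) a
iter-* H zero    n a = refl
iter-* H (suc m) n a = trans (iter-+ H n (m ℕ.* n) a) (cong (iter n H) (iter-* H m n a))

iter-dependsOn-≥ : ∀ {d} {H : Op d} lo → DependsOn H (+ lo ℤ.≤_) → ∀ n → DependsOn (iter n H) (+ (n ℕ.* lo) ℤ.≤_)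
iter-dependsOn-≥ lo H-lo zero c c′ x agree =
  subst (λ y → c y ≡ c′ y) (ℤₚ.+-identityʳ x) (agree (+ 0) ℤₚ.≤-refl)
iter-dependsOn-≥ lo H-lo (suc n) =
  DependsOn-mono sum-bound (DependsOn-∘ H-lo (iter-dependsOn-≥ lo H-lo n))
  where
  sum-bound : ∀ {k} → ((+ lo ℤ.≤_) +ˢ (+ (n ℕ.* lo) ℤ.≤_)) k → + (suc n ℕ.* lo) ℤ.≤ k
  sum-bound (i , j , lo≤i , nlo≤j , refl) = ℤₚ.+-mono-≤ lo≤i nlo≤j

iter-cancel : ∀ {d} {F H : Op d} → Extensional F → (∀ c → F (H c) ≗ c) →
  ∀ m n c → iter m F (iter (m ℕ.+ n) H c) ≗ iter n H c
iter-cancel F-ext FH≗id zero    n c x = refl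
iter-cancel {F = F} {H} F-ext FH≗id (suc m) n c x = begin
  iter (suc m) F (H (iter (m ℕ.+ n) H c)) x  ≡⟨ cong (_$ x) (iter-suc F m _) ⟩
  iter m F (F (H (iter (m ℕ.+ n) H c))) x    ≡⟨ iter-extensional F-ext m (FH≗id _) x ⟩
  iter m F (iter (m ℕ.+ n) H c) x            ≡⟨ iter-cancel F-ext FH≗id m n c x ⟩
  iter n H c x                               ∎
  where open ≡-Reasoning

iter-intertwine : ∀ {d} {K K₂ T : Op d} → Extensional K → (∀ c → K (T c) ≗ T (K₂ c)) →
  ∀ y c → iter y K (T c) ≗ T (iter y K₂ c)
iter-intertwine K-ext KT≗TK₂ zero    c x = refl
iter-intertwine K-ext KT≗TK₂ (suc y) c x =
  trans (K-ext (iter-intertwine K-ext KT≗TK₂ y c) x) (KT≗TK₂ _ x)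

module _ {d : ℕ} {H E : Op d} (H-ext : Extensional H) (H-add : Additive H)
         (H≗𝟙+E : ∀ c → H c ≗ c ⊕ᶜ E c) where

  -- (𝟙 + E)² = 𝟙 + E² in characteristic 2
  iter-2^-𝟙+ : ∀ M c → iter (2 ℕ.^ M) H c ≗ c ⊕ᶜ iter (2 ℕ.^ M) E c
  iter-2^-𝟙+ zero    c x = H≗𝟙+E c x
  iter-2^-𝟙+ (suc M) c x = begin
    iter (m ℕ.+ (m ℕ.+ 0)) H c x            ≡⟨ cong (λ n → iter (m ℕ.+ n) H c x) (ℕₚ.+-identityʳ m) ⟩
    iter (m ℕ.+ m) H c x                    ≡⟨ cong (_$ x) (iter-+ H m m c) ⟩
    iter m H (iter m H c) x                 ≡⟨ iter-extensional H-ext m (iter-2^-𝟙+ M c) x ⟩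
    iter m H (c ⊕ᶜ iter m E c) x            ≡⟨ iter-additive H-ext H-add m c _ x ⟩
    iter m H c x ⊕ iter m H (iter m E c) x  ≡⟨ cong₂ _⊕_ (iter-2^-𝟙+ M c x) (iter-2^-𝟙+ M (iter m E c) x) ⟩
    (c x ⊕ e) ⊕ (e ⊕ e′)                    ≡⟨ ⊕-assoc (c x) e (e ⊕ e′) ⟩
    c x ⊕ (e ⊕ (e ⊕ e′))                    ≡⟨ cong (c x ⊕_) (⊕-cancelˡ e e′) ⟩
    c x ⊕ e′                                ≡⟨ cong (λ f → c x ⊕ f x) (iter-+ E m m c) ⟨
    c x ⊕ iter (m ℕ.+ m) E c x              ≡⟨ cong (λ n → c x ⊕ iter (m ℕ.+ n) E c x) (ℕₚ.+-identityʳ m) ⟨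
    c x ⊕ iter (m ℕ.+ (m ℕ.+ 0)) E c x      ∎
    where
    open ≡-Reasoning
    m = 2 ℕ.^ M
    e = iter m E c x
    e′ = iter m E (iter m E c) x

-- Laurent matrices as linear cellular automata

keys : ∀ {d} → LaurentMatrix d → List ℤ
keys = List.map proj₁

module _ {d : ℕ} where

  linCA-dependsOn-keys : (L : LaurentMatrix d) → DependsOn (linCA L) (_∈ keys L)
  linCA-dependsOn-keys []             c c′ x agree = refl
  linCA-dependsOn-keys ((k , M) ∷ L) c c′ x agree =
    cong₂ _⊕_ (cong (M ·_) (agree k (here refl)))
              (linCA-dependsOn-keys L c c′ x (λ k′ k′∈L → agree k′ (there k′∈L)))

  linCA-dependsOn : ∀ {S} (L : LaurentMatrix d) → All S (keys L) → DependsOn (linCA L) S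
  linCA-dependsOn L bound = DependsOn-mono (All.lookup bound) (linCA-dependsOn-keys L)

  linCA-extensional : (L : LaurentMatrix d) → Extensional (linCA L)
  linCA-extensional L = DependsOn⇒Extensional (linCA-dependsOn-keys L)

  linCA-additive : (L : LaurentMatrix d) → Additive (linCA L)
  linCA-additive []             c c′ x = sym (⊕-self 𝟘)
  linCA-additive ((k , M) ∷ L) c c′ x =
    trans (cong₂ _⊕_ (·-⊕ M (c (x ℤ.- k)) (c′ (x ℤ.- k))) (linCA-additive L c c′ x))
          (⊕-interchange _ _ _ _)

  linCA-++ : (A B : LaurentMatrix d) (c : Config d) → linCA (A ++ B) c ≗ linCA A c ⊕ᶜ linCA B c
  linCA-++ []             B c x = sym (⊕-identityˡ _)
  linCA-++ ((k , M) ∷ A) B c x =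
    trans (cong ((M · c (x ℤ.- k)) ⊕_) (linCA-++ A B c x)) (sym (⊕-assoc _ _ _))

  linCA-shift : (L : LaurentMatrix d) (a : ℤ) (c : Config d) (x : ℤ) → linCA L (shift a c) x ≡ linCA L c (x ℤ.- a)
  linCA-shift []             a c x = refl
  linCA-shift ((k , M) ∷ L) a c x =
    cong₂ _⊕_ (cong (λ y → M · c y) (sub-comm x k a)) (linCA-shift L a c x)
    where
    sub-comm : ∀ x k a → (x ℤ.- k) ℤ.- a ≡ (x ℤ.- a) ℤ.- k
    sub-comm = ℤsolve-∀

  uᴸ : ℤ → LaurentMatrix d
  uᴸ a = (a , 𝟙ᴹ) ∷ []

  linCA-uᴸ : ∀ a (c : Config d) → linCA (uᴸ a) c ≗ shift a c
  linCA-uᴸ a c x = trans (⊕-identityʳ _) (𝟙ᴹ-· _)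

  𝟙ᴸ : LaurentMatrix d
  𝟙ᴸ = uᴸ (+ 0)

  linCA-𝟙ᴸ : (c : Config d) → linCA 𝟙ᴸ c ≗ c
  linCA-𝟙ᴸ c x = trans (linCA-uᴸ (+ 0) c x) (cong c (ℤₚ.+-identityʳ x))

  _⋆_ : LaurentMatrix d → LaurentMatrix d → LaurentMatrix d
  []             ⋆ B = []
  ((k , M) ∷ A) ⋆ B = List.map (λ (l , N) → (k ℤ.+ l , M *ᴹ N)) B ++ (A ⋆ B)

  linCA-⋆ : (A B : LaurentMatrix d) (c : Config d) → linCA A (linCA B c) ≗ linCA (A ⋆ B) c
  linCA-⋆ []             B c x = refl
  linCA-⋆ ((k , M) ∷ A) B c x =
    trans (cong₂ _⊕_ (term B) (linCA-⋆ A B c x)) (sym (linCA-++ (List.map _ B) (A ⋆ B) c x))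
    where
    term : ∀ B → M · linCA B c (x ℤ.- k) ≡ linCA (List.map (λ (l , N) → (k ℤ.+ l , M *ᴹ N)) B) c x
    term []             = ·-𝟘 M
    term ((l , N) ∷ B) =
      trans (·-⊕ M _ _)
        (cong₂ _⊕_ (trans (sym (*ᴹ-· M N _)) (cong (λ y → (M *ᴹ N) · c y) (sym (sub-sub x k l))))
                   (term B))

  insert : ℤ → Matrix d → LaurentMatrix d → LaurentMatrix d
  insert k M [] = (k , M) ∷ []
  insert k M ((k′ , M′) ∷ L) with k ℤ.≟ k′
  ... | yes _ = (k′ , M +ᴹ M′) ∷ L
  ... | no  _ = (k′ , M′) ∷ insert k M L

  linCA-insert : ∀ k M L (c : Config d) x → linCA (insert k M L) c x ≡ (M · c (x ℤ.- k)) ⊕ linCA L c x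
  linCA-insert k M []               c x = refl
  linCA-insert k M ((k′ , M′) ∷ L) c x with k ℤ.≟ k′
  ... | yes refl = trans (cong (_⊕ linCA L c x) (+ᴹ-· M M′ _)) (⊕-assoc _ _ _)
  ... | no  _    = trans (cong (_ ⊕_) (linCA-insert k M L c x)) (⊕-swap _ _ _)
    where
    ⊕-swap : (u v w : State d) → u ⊕ (v ⊕ w) ≡ v ⊕ (u ⊕ w)
    ⊕-swap u v w = trans (sym (⊕-assoc u v w)) (trans (cong (_⊕ w) (⊕-comm u v)) (⊕-assoc v u w))

  dropZeros : LaurentMatrix d → LaurentMatrix d
  dropZeros [] = []
  dropZeros ((k , M) ∷ L) with Vecₚ.≡-dec (Vecₚ.≡-dec Boolₚ._≟_) M 𝟘ᴹ
  ... | yes _ = dropZeros L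
  ... | no  _ = (k , M) ∷ dropZeros L

  linCA-dropZeros : ∀ L (c : Config d) → linCA (dropZeros L) c ≗ linCA L c
  linCA-dropZeros [] c x = refl
  linCA-dropZeros ((k , M) ∷ L) c x with Vecₚ.≡-dec (Vecₚ.≡-dec Boolₚ._≟_) M 𝟘ᴹ
  ... | yes refl = trans (linCA-dropZeros L c x)
                         (sym (trans (cong (_⊕ linCA L c x) (𝟘ᴹ-· _)) (⊕-identityˡ _)))
  ... | no  _    = cong (_ ⊕_) (linCA-dropZeros L c x)

  normalise : LaurentMatrix d → LaurentMatrix d
  normalise L = dropZeros (List.foldr (λ (k , M) → insert k M) [] L)

  linCA-normalise : ∀ L (c : Config d) → linCA (normalise L) c ≗ linCA L c
  linCA-normalise L c x = trans (linCA-dropZeros (collect L) c x) (linCA-collect L)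
    where
    collect = List.foldr (λ (k , M) → insert k M) []
    linCA-collect : ∀ L → linCA (collect L) c x ≡ linCA L c x
    linCA-collect []             = refl
    linCA-collect ((k , M) ∷ L) =
      trans (linCA-insert k M (collect L) c x) (cong (_ ⊕_) (linCA-collect L))

  linCA-≗-by-normalise : ∀ A B → normalise (A ++ B) ≡ [] → ∀ (c : Config d) → linCA A c ≗ linCA B c
  linCA-≗-by-normalise A B A+B≡0 c x = ⊕-zero⇒≡ _ _ (begin
    linCA A c x ⊕ linCA B c x       ≡⟨ linCA-++ A B c x ⟨
    linCA (A ++ B) c x              ≡⟨ linCA-normalise (A ++ B) c x ⟨
    linCA (normalise (A ++ B)) c x  ≡⟨ cong (λ L → linCA L c x) A+B≡0 ⟩
    𝟘                               ∎)
    where open ≡-Reasoning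

  power : LaurentMatrix d → ℕ → LaurentMatrix d
  power L zero    = 𝟙ᴸ
  power L (suc n) = normalise (L ⋆ power L n)

  linCA-split : ∀ A B (c : Config d) x → linCA A c x ≡ linCA B c x ⊕ linCA (normalise (A ++ B)) c x
  linCA-split A B c x = sym (begin
    b ⊕ linCA (normalise (A ++ B)) c x  ≡⟨ cong (b ⊕_) (linCA-normalise (A ++ B) c x) ⟩
    b ⊕ linCA (A ++ B) c x              ≡⟨ cong (b ⊕_) (linCA-++ A B c x) ⟩
    b ⊕ (a ⊕ b)                         ≡⟨ cong (b ⊕_) (⊕-comm a b) ⟩
    b ⊕ (b ⊕ a)                         ≡⟨ ⊕-cancelˡ b a ⟩
    a                                   ∎)
    where
    open ≡-Reasoning
    a = linCA A c x
    b = linCA B c x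

  dilate : LaurentMatrix d → LaurentMatrix d
  dilate = List.map (λ (k , M) → (k ℤ.+ k , M))

  coset : Config d → ℤ → Config d
  coset c e h = c (e ℤ.+ h ℤ.* + 2)

  linCA-dilate : ∀ L (c : Config d) e h → linCA (dilate L) c (e ℤ.+ h ℤ.* + 2) ≡ linCA L (coset c e) h
  linCA-dilate []             c e h = refl
  linCA-dilate ((k , M) ∷ L) c e h =
    cong₂ _⊕_ (cong (λ y → M · c y) (dilated-offset e h k)) (linCA-dilate L c e h)
    where
    dilated-offset : ∀ e h k → (e ℤ.+ h ℤ.* + 2) ℤ.- (k ℤ.+ k) ≡ e ℤ.+ (h ℤ.- k) ℤ.* + 2
    dilated-offset = ℤsolve-∀

module LinearCA {d} {H : Op d} (L : LaurentMatrix d) (H≗L : ∀ c → H c ≗ linCA L c) where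

  extensional : Extensional H
  extensional c≗c′ x = trans (H≗L _ x) (trans (linCA-extensional L c≗c′ x) (sym (H≗L _ x)))

  additive : Additive H
  additive c c′ x =
    trans (H≗L _ x) (trans (linCA-additive L c c′ x) (sym (cong₂ _⊕_ (H≗L c x) (H≗L c′ x))))

  dependsOn : ∀ {S} → All S (keys L) → DependsOn H S
  dependsOn bound = DependsOn-≗ H≗L (linCA-dependsOn L bound)

  iter≗power : ∀ n c → iter n H c ≗ linCA (power L n) c
  iter≗power zero    c x = sym (linCA-𝟙ᴸ c x)
  iter≗power (suc n) c x = begin
    H (iter n H c) x                 ≡⟨ H≗L _ x ⟩
    linCA L (iter n H c) x           ≡⟨ linCA-extensional L (iter≗power n c) x ⟩
    linCA L (linCA (power L n) c) x  ≡⟨ linCA-⋆ L (power L n) c x ⟩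
    linCA (L ⋆ power L n) c x        ≡⟨ linCA-normalise (L ⋆ power L n) c x ⟨
    linCA (power L (suc n)) c x      ∎
    where open ≡-Reasoning

  shift-commute : ∀ a c x → H (shift a c) x ≡ H c (x ℤ.- a)
  shift-commute a c x = trans (H≗L _ x) (trans (linCA-shift L a c x) (sym (H≗L c _)))

  iter-shift : ∀ n a c x → iter n H (shift a c) x ≡ iter n H c (x ℤ.- a)
  iter-shift zero    a c x = refl
  iter-shift (suc n) a c x =
    trans (extensional (iter-shift n a c) x) (shift-commute a (iter n H c) x)

-- Decompositions H^y = u^a + R

Outside : ℤ → ℕ → ℤ → Set
Outside a l k = k ℤ.+ + suc l ℤ.≤ a ⊎ a ℤ.+ + suc l ℤ.≤ k

Decomposition : ∀ {d} → Op d → ℕ → ℤ → ℕ → Set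
Decomposition {d} H y a l =
  Σ (Op d) λ R → (∀ c → iter y H c ≗ shift a c ⊕ᶜ R c) × DependsOn R (Outside a l)

module _ {d} {H H₂ : Op d} (H-ext : Extensional H)
         (H₂-dilates : ∀ c e h → H₂ c (e ℤ.+ h ℤ.* + 2) ≡ H (coset c e) h) where

  iter-dilates : ∀ y c e h → iter y H₂ c (e ℤ.+ h ℤ.* + 2) ≡ iter y H (coset c e) h
  iter-dilates zero    c e h = refl
  iter-dilates (suc y) c e h = trans (H₂-dilates _ e h) (H-ext (iter-dilates y c e) h)

  decomposition-dilate : ∀ {y a l} → Decomposition H y a l → Decomposition H₂ y (a ℤ.+ a) (suc (l ℕ.+ l))
  decomposition-dilate {y} {a} {l} (R , H^y≗ , R-dep) = R₂ , H₂^y≗ , R₂-dep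
    where
    residue : ℤ → ℤ
    residue z = + (z ℤ.%ℕ 2)
    R₂ : Op d
    R₂ c z = R (coset c (residue z)) (z ℤ./ℕ 2)
    split : ∀ z → residue z ℤ.+ (z ℤ./ℕ 2) ℤ.* + 2 ≡ z
    split z = sym (ℤDivMod.a≡a%ℕn+[a/ℕn]*n z 2)
    coset-offset : ∀ z k → residue z ℤ.+ (z ℤ./ℕ 2 ℤ.- k) ℤ.* + 2 ≡ z ℤ.- (k ℤ.+ k)
    coset-offset z k = trans (regroup (residue z) (z ℤ./ℕ 2) k) (cong (ℤ._- (k ℤ.+ k)) (split z))
      where
      regroup : ∀ e h k → e ℤ.+ (h ℤ.- k) ℤ.* + 2 ≡ (e ℤ.+ h ℤ.* + 2) ℤ.- (k ℤ.+ k)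
      regroup = ℤsolve-∀
    H₂^y≗ : ∀ c z → iter y H₂ c z ≡ c (z ℤ.- (a ℤ.+ a)) ⊕ R₂ c z
    H₂^y≗ c z = begin
      iter y H₂ c z                                        ≡⟨ cong (iter y H₂ c) (split z) ⟨
      iter y H₂ c (residue z ℤ.+ (z ℤ./ℕ 2) ℤ.* + 2)       ≡⟨ iter-dilates y c (residue z) (z ℤ./ℕ 2) ⟩
      iter y H (coset c (residue z)) (z ℤ./ℕ 2)            ≡⟨ H^y≗ (coset c (residue z)) (z ℤ./ℕ 2) ⟩
      c (residue z ℤ.+ (z ℤ./ℕ 2 ℤ.- a) ℤ.* + 2) ⊕ R₂ c z  ≡⟨ cong (λ w → c w ⊕ R₂ c z) (coset-offset z a) ⟩
      c (z ℤ.- (a ℤ.+ a)) ⊕ R₂ c z                         ∎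
      where open ≡-Reasoning
    R₂-dep : DependsOn R₂ (Outside (a ℤ.+ a) (suc (l ℕ.+ l)))
    R₂-dep c c′ z agree = R-dep (coset c (residue z)) (coset c′ (residue z)) (z ℤ./ℕ 2) λ k k-out →
      subst (λ w → c w ≡ c′ w) (sym (coset-offset z k)) (agree (k ℤ.+ k) (doubled-outside k-out))
      where
      open ℤₚ.≤-Reasoning
      double : ∀ k l → (k ℤ.+ (+ 1 ℤ.+ l)) ℤ.+ (k ℤ.+ (+ 1 ℤ.+ l)) ≡ (k ℤ.+ k) ℤ.+ (+ 1 ℤ.+ (+ 1 ℤ.+ (l ℤ.+ l)))
      double = ℤsolve-∀
      doubled-outside : ∀ {k} → Outside a l k → Outside (a ℤ.+ a) (suc (l ℕ.+ l)) (k ℤ.+ k)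
      doubled-outside {k} (inj₁ k+[1+l]≤a) = inj₁ (begin
        (k ℤ.+ k) ℤ.+ + suc (suc (l ℕ.+ l))  ≡⟨ double k (+ l) ⟨
        (k ℤ.+ + suc l) ℤ.+ (k ℤ.+ + suc l)  ≤⟨ ℤₚ.+-mono-≤ k+[1+l]≤a k+[1+l]≤a ⟩
        a ℤ.+ a                              ∎)
      doubled-outside {k} (inj₂ a+[1+l]≤k) = inj₂ (begin
        (a ℤ.+ a) ℤ.+ + suc (suc (l ℕ.+ l))  ≡⟨ double a (+ l) ⟨
        (a ℤ.+ + suc l) ℤ.+ (a ℤ.+ + suc l)  ≤⟨ ℤₚ.+-mono-≤ a+[1+l]≤k a+[1+l]≤k ⟩
        k ℤ.+ k                              ∎)

private
  a+[1+l]≰a : ∀ a l → ¬ (a ℤ.+ + suc l ℤ.≤ a)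
  a+[1+l]≰a a l a+[1+l]≤a =
    1+l≰0 (subst₂ ℤ._≤_ (cancel a (+ suc l)) (ℤₚ.+-inverseʳ a) (ℤₚ.+-monoˡ-≤ (ℤ.- a) a+[1+l]≤a))
    where
    1+l≰0 : ¬ (+ suc l ℤ.≤ + 0)
    1+l≰0 (ℤ.+≤+ ())
    cancel : ∀ a b → (a ℤ.+ b) ℤ.- a ≡ b
    cancel = ℤsolve-∀

  window⇒¬Outside : ∀ a l z → a ℤ.- + l ℤ.≤ z → z ℤ.≤ a ℤ.+ + l → ¬ Outside a l z
  window⇒¬Outside a l z a-l≤z z≤a+l (inj₁ z+[1+l]≤a) =
    a+[1+l]≰a a 0 (ℤₚ.≤-trans (ℤₚ.≤-reflexive (regroup a (+ l))) (ℤₚ.≤-trans (ℤₚ.+-monoˡ-≤ (+ suc l) a-l≤z) z+[1+l]≤a))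
    where
    regroup : ∀ a l → a ℤ.+ + 1 ≡ (a ℤ.- l) ℤ.+ (+ 1 ℤ.+ l)
    regroup = ℤsolve-∀
  window⇒¬Outside a l z a-l≤z z≤a+l (inj₂ a+[1+l]≤z) =
    a+[1+l]≰a (a ℤ.+ + l) 0 (ℤₚ.≤-trans (ℤₚ.≤-reflexive (regroup a (+ l))) (ℤₚ.≤-trans a+[1+l]≤z z≤a+l))
    where
    regroup : ∀ a l → (a ℤ.+ l) ℤ.+ + 1 ≡ a ℤ.+ (+ 1 ℤ.+ l)
    regroup = ℤsolve-∀

φ-≢ : ∀ {d} (c : Config d) q {w} → w ≢ + 0 → φ c q w ≡ c w
φ-≢ c q {w} w≢0 with w ℤ.≟ + 0
... | yes w≡0 = contradiction w≡0 w≢0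
... | no  _   = refl

decomposition⇒P : ∀ {d} {H : Op d} {y a l} → Decomposition H y a l → P H a y l l
decomposition⇒P {d} {H} {y} {a} {l} (R , H^y≗ , R-dep) = bijective , constant
  where
  R-window : ∀ c q q′ z → a ℤ.- + l ℤ.≤ z → z ℤ.≤ a ℤ.+ + l → R (φ c q) z ≡ R (φ c q′) z
  R-window c q q′ z a-l≤z z≤a+l = R-dep (φ c q) (φ c q′) z λ k k-out →
    let z-k≢0 : z ℤ.- k ≢ + 0
        z-k≢0 z-k≡0 = window⇒¬Outside a l z a-l≤z z≤a+l
                        (subst (Outside a l) (sym (ℤₚ.i-j≡0⇒i≡j z k z-k≡0)) k-out)
    in trans (φ-≢ c q z-k≢0) (sym (φ-≢ c q′ z-k≢0))
  K : Config d → State d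
  K c = R (φ c 𝟘) a
  local-at-a : ∀ c q → local H y a c q ≡ q ⊕ K c
  local-at-a c q = trans (H^y≗ (φ c q) a)
    (cong₂ _⊕_ (cong (φ c q) (ℤₚ.+-inverseʳ a)) (R-window c q 𝟘 a (ℤₚ.i-j≤i a (+ l)) (ℤₚ.i≤i+j a (+ l))))
  bijective : (c : Config d) → Bijective _≡_ _≡_ (local H y a c)
  bijective c = injective , surjective
    where
    injective : ∀ {q q′} → local H y a c q ≡ local H y a c q′ → q ≡ q′
    injective {q} {q′} same = begin
      q                 ≡⟨ ⊕-cancelʳ q (K c) ⟨
      (q ⊕ K c) ⊕ K c   ≡⟨ cong (_⊕ K c) (trans (sym (local-at-a c q)) (trans same (local-at-a c q′))) ⟩
      (q′ ⊕ K c) ⊕ K c  ≡⟨ ⊕-cancelʳ q′ (K c) ⟩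
      q′                ∎
      where open ≡-Reasoning
    surjective : ∀ w → ∃[ q ] (∀ {q′} → q′ ≡ q → local H y a c q′ ≡ w)
    surjective w = w ⊕ K c , λ { refl → trans (local-at-a c (w ⊕ K c)) (⊕-cancelʳ w (K c)) }
  constant : (c : Config d) (z : ℤ) → a ℤ.- + l ℤ.≤ z → z ℤ.≤ a ℤ.+ + l → z ≢ a →
             (q q′ : State d) → local H y z c q ≡ local H y z c q′
  constant c z a-l≤z z≤a+l z≢a q q′ = begin
    local H y z c q                         ≡⟨ H^y≗ (φ c q) z ⟩
    φ c q (z ℤ.- a) ⊕ R (φ c q) z           ≡⟨ cong₂ _⊕_ (trans (φ-≢ c q z-a≢0) (sym (φ-≢ c q′ z-a≢0)))
                                                        (R-window c q q′ z a-l≤z z≤a+l) ⟩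
    φ c q′ (z ℤ.- a) ⊕ R (φ c q′) z         ≡⟨ H^y≗ (φ c q′) z ⟨
    local H y z c q′                        ∎
    where
    open ≡-Reasoning
    z-a≢0 : z ℤ.- a ≢ + 0
    z-a≢0 = z≢a ∘ ℤₚ.i-j≡0⇒i≡j z a

-- The automaton Γ

pattern O = false
pattern I = true

matrix : Bool → Bool → Bool → Bool → Bool → Bool → Bool → Bool → Bool → Matrix 3
matrix a b c d e f g h i = (a ∷ b ∷ c ∷ []) ∷ (d ∷ e ∷ f ∷ []) ∷ (g ∷ h ∷ i ∷ []) ∷ []

Γ⁻¹ : LaurentMatrix 3
Γ⁻¹ = (+ 0 , matrix O O I  O I O  I O O) ∷ (+ 1 , matrix O I O  I O O  O O O) ∷ (+ 2 , matrix I O O  O O O  O O O) ∷ []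

Γ+𝟙 : LaurentMatrix 3
Γ+𝟙 = ΓMat ++ 𝟙ᴸ

Π : LaurentMatrix 3
Π = (+ 0 , matrix I I I  O O O  O I O) ∷ (+ 1 , matrix O O O  O I I  O O O) ∷ []

Π⁻¹ : LaurentMatrix 3
Π⁻¹ = (+ 0 , matrix I O O  O O I  O O I) ∷ (-[1+ 0 ] , matrix O I O  O O O  O I O) ∷ []

Γ⁻¹-certificate : normalise ((Γ⁻¹ ⋆ ΓMat) ++ 𝟙ᴸ) ≡ []
Γ⁻¹-certificate = refl

Π-conjugation-certificate : normalise ((ΓMat ⋆ (ΓMat ⋆ Π)) ++ (Π ⋆ dilate ΓMat)) ≡ []
Π-conjugation-certificate = refl

Π⁻¹-certificate : normalise ((Π ⋆ Π⁻¹) ++ 𝟙ᴸ) ≡ []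
Π⁻¹-certificate = refl

-- Opaque so that these normalised products are only ever computed in the key checks.
opaque
  Γ⁻⁴+𝟙 : LaurentMatrix 3
  Γ⁻⁴+𝟙 = normalise (power Γ⁻¹ 4 ++ 𝟙ᴸ)

  Γ⁻⁴+𝟙-definition : Γ⁻⁴+𝟙 ≡ normalise (power Γ⁻¹ 4 ++ 𝟙ᴸ)
  Γ⁻⁴+𝟙-definition = refl

  Γ⁻⁴+𝟙-keys : All (Within (+ 2) (+ 8)) (keys Γ⁻⁴+𝟙)
  Γ⁻⁴+𝟙-keys = from-yes (All.all? (within? (+ 2) (+ 8)) (keys Γ⁻⁴+𝟙))

  Γ⁻¹²+u¹⁶Γ⁻⁴ : LaurentMatrix 3
  Γ⁻¹²+u¹⁶Γ⁻⁴ = normalise (power Γ⁻¹ 12 ++ (uᴸ (+ 16) ⋆ power Γ⁻¹ 4))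

  Γ⁻¹²+u¹⁶Γ⁻⁴-definition : Γ⁻¹²+u¹⁶Γ⁻⁴ ≡ normalise (power Γ⁻¹ 12 ++ (uᴸ (+ 16) ⋆ power Γ⁻¹ 4))
  Γ⁻¹²+u¹⁶Γ⁻⁴-definition = refl

  Γ⁻¹²+u¹⁶Γ⁻⁴-keys : All (Within (+ 0) (+ 12)) (keys Γ⁻¹²+u¹⁶Γ⁻⁴)
  Γ⁻¹²+u¹⁶Γ⁻⁴-keys = from-yes (All.all? (within? (+ 0) (+ 12)) (keys Γ⁻¹²+u¹⁶Γ⁻⁴))

Γ⁻¹-keys : All (+ 0 ℤ.≤_) (keys Γ⁻¹)
Γ⁻¹-keys = from-yes (All.all? (+ 0 ℤ.≤?_) (keys Γ⁻¹))

Γ+𝟙-keys : All (+ 0 ℤ.≤_) (keys Γ+𝟙)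
Γ+𝟙-keys = from-yes (All.all? (+ 0 ℤ.≤?_) (keys Γ+𝟙))

Π-keys : All (Within (+ 0) (+ 1)) (keys Π)
Π-keys = from-yes (All.all? (within? (+ 0) (+ 1)) (keys Π))

Π⁻¹-keys : All (Within (ℤ.- + 1) (+ 0)) (keys Π⁻¹)
Π⁻¹-keys = from-yes (All.all? (within? (ℤ.- + 1) (+ 0)) (keys Π⁻¹))

Γ+𝟙³-keys : All (+ 2 ℤ.≤_) (keys (power Γ+𝟙 3))
Γ+𝟙³-keys = from-yes (All.all? (+ 2 ℤ.≤?_) (keys (power Γ+𝟙 3)))

Γ⁻⁸-keys : All (Within (+ 0) (+ 16)) (keys (power Γ⁻¹ 8))
Γ⁻⁸-keys = from-yes (All.all? (within? (+ 0) (+ 16)) (keys (power Γ⁻¹ 8)))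

-- Opaque copies of linCA: with a transparent linCA, comparing iterates such as iter 12 (linCA Γ⁻¹) c x
-- makes Agda unfold them, which blows up exponentially.
opaque
  ⟦Γ⁻¹⟧ ⟦Γ+𝟙⟧ ⟦Π⟧ ⟦Π⁻¹⟧ ⟦Γ₂⟧ : Op 3
  ⟦Γ⁻¹⟧ = linCA Γ⁻¹
  ⟦Γ+𝟙⟧ = linCA Γ+𝟙
  ⟦Π⟧   = linCA Π
  ⟦Π⁻¹⟧ = linCA Π⁻¹
  ⟦Γ₂⟧  = linCA (dilate ΓMat)

  ⟦Γ⁻¹⟧-definition : ∀ c → ⟦Γ⁻¹⟧ c ≗ linCA Γ⁻¹ c
  ⟦Γ⁻¹⟧-definition c x = refl

  ⟦Γ+𝟙⟧-definition : ∀ c → ⟦Γ+𝟙⟧ c ≗ linCA Γ+𝟙 c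
  ⟦Γ+𝟙⟧-definition c x = refl

  ⟦Π⟧-definition : ∀ c → ⟦Π⟧ c ≗ linCA Π c
  ⟦Π⟧-definition c x = refl

  ⟦Π⁻¹⟧-definition : ∀ c → ⟦Π⁻¹⟧ c ≗ linCA Π⁻¹ c
  ⟦Π⁻¹⟧-definition c x = refl

  ⟦Γ₂⟧-definition : ∀ c → ⟦Γ₂⟧ c ≗ linCA (dilate ΓMat) c
  ⟦Γ₂⟧-definition c x = refl

module Γ = LinearCA ΓMat (λ c x → refl)
module ⟦Γ⁻¹⟧ = LinearCA Γ⁻¹ ⟦Γ⁻¹⟧-definition
module ⟦Γ+𝟙⟧ = LinearCA Γ+𝟙 ⟦Γ+𝟙⟧-definition
module ⟦Π⟧ = LinearCA Π ⟦Π⟧-definition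
module ⟦Π⁻¹⟧ = LinearCA Π⁻¹ ⟦Π⁻¹⟧-definition

⟦Γ⁻¹⟧∘Γ≗id : ∀ c → ⟦Γ⁻¹⟧ (Γ c) ≗ c
⟦Γ⁻¹⟧∘Γ≗id c x = begin
  ⟦Γ⁻¹⟧ (Γ c) x               ≡⟨ ⟦Γ⁻¹⟧-definition (Γ c) x ⟩
  linCA Γ⁻¹ (linCA ΓMat c) x  ≡⟨ linCA-⋆ Γ⁻¹ ΓMat c x ⟩
  linCA (Γ⁻¹ ⋆ ΓMat) c x      ≡⟨ linCA-≗-by-normalise (Γ⁻¹ ⋆ ΓMat) 𝟙ᴸ Γ⁻¹-certificate c x ⟩
  linCA 𝟙ᴸ c x                ≡⟨ linCA-𝟙ᴸ c x ⟩
  c x                         ∎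
  where open ≡-Reasoning

Γ≗id+⟦Γ+𝟙⟧ : ∀ c → Γ c ≗ c ⊕ᶜ ⟦Γ+𝟙⟧ c
Γ≗id+⟦Γ+𝟙⟧ c x = sym (begin
  c x ⊕ ⟦Γ+𝟙⟧ c x               ≡⟨ cong (c x ⊕_) (trans (⟦Γ+𝟙⟧-definition c x) (linCA-++ ΓMat 𝟙ᴸ c x)) ⟩
  c x ⊕ (Γ c x ⊕ linCA 𝟙ᴸ c x)  ≡⟨ cong (λ v → c x ⊕ (Γ c x ⊕ v)) (linCA-𝟙ᴸ c x) ⟩
  c x ⊕ (Γ c x ⊕ c x)           ≡⟨ cong (c x ⊕_) (⊕-comm (Γ c x) (c x)) ⟩
  c x ⊕ (c x ⊕ Γ c x)           ≡⟨ ⊕-cancelˡ (c x) (Γ c x) ⟩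
  Γ c x                         ∎)
  where open ≡-Reasoning

Γ^2^≗id+⟦Γ+𝟙⟧^2^ : ∀ M c → iter (2 ℕ.^ M) Γ c ≗ c ⊕ᶜ iter (2 ℕ.^ M) ⟦Γ+𝟙⟧ c
Γ^2^≗id+⟦Γ+𝟙⟧^2^ = iter-2^-𝟙+ Γ.extensional Γ.additive Γ≗id+⟦Γ+𝟙⟧

⟦Γ+𝟙⟧^n-dependsOn : ∀ n → DependsOn (iter n ⟦Γ+𝟙⟧) (+ (n ℕ./ 3 ℕ.* 2) ℤ.≤_)
⟦Γ+𝟙⟧^n-dependsOn n = DependsOn-≗ split (DependsOn-mono bound (DependsOn-∘ E^r-≥0 E^3q-≥2q))
  where
  q = n ℕ./ 3
  r = n ℕ.% 3
  split : ∀ c → iter n ⟦Γ+𝟙⟧ c ≗ iter r ⟦Γ+𝟙⟧ (iter q (iter 3 ⟦Γ+𝟙⟧) c)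
  split c x = begin
    iter n ⟦Γ+𝟙⟧ c x                          ≡⟨ cong (λ k → iter k ⟦Γ+𝟙⟧ c x) (ℕDivMod.m≡m%n+[m/n]*n n 3) ⟩
    iter (r ℕ.+ q ℕ.* 3) ⟦Γ+𝟙⟧ c x            ≡⟨ cong (_$ x) (iter-+ ⟦Γ+𝟙⟧ r (q ℕ.* 3) c) ⟩
    iter r ⟦Γ+𝟙⟧ (iter (q ℕ.* 3) ⟦Γ+𝟙⟧ c) x   ≡⟨ cong (λ c′ → iter r ⟦Γ+𝟙⟧ c′ x) (iter-* ⟦Γ+𝟙⟧ q 3 c) ⟩
    iter r ⟦Γ+𝟙⟧ (iter q (iter 3 ⟦Γ+𝟙⟧) c) x  ∎
    where open ≡-Reasoning
  E^r-≥0 : DependsOn (iter r ⟦Γ+𝟙⟧) (+ (r ℕ.* 0) ℤ.≤_)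
  E^r-≥0 = iter-dependsOn-≥ 0 (⟦Γ+𝟙⟧.dependsOn Γ+𝟙-keys) r
  E³-≥2 : DependsOn (iter 3 ⟦Γ+𝟙⟧) (+ 2 ℤ.≤_)
  E³-≥2 = DependsOn-≗ (⟦Γ+𝟙⟧.iter≗power 3) (linCA-dependsOn (power Γ+𝟙 3) Γ+𝟙³-keys)
  E^3q-≥2q : DependsOn (iter q (iter 3 ⟦Γ+𝟙⟧)) (+ (q ℕ.* 2) ℤ.≤_)
  E^3q-≥2q = iter-dependsOn-≥ 2 E³-≥2 q
  bound : ∀ {k} → ((+ (r ℕ.* 0) ℤ.≤_) +ˢ (+ (q ℕ.* 2) ℤ.≤_)) k → + (q ℕ.* 2) ℤ.≤ k
  bound (i , j , 0≤i , 2q≤j , refl) =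
    subst (ℤ._≤ i ℤ.+ j) (cong (λ a → + (a ℕ.+ q ℕ.* 2)) (ℕₚ.*-zeroʳ r)) (ℤₚ.+-mono-≤ 0≤i 2q≤j)

⟦Γ⁻¹⟧^n-dependsOn-≥0 : ∀ m → DependsOn (iter m ⟦Γ⁻¹⟧) (+ 0 ℤ.≤_)
⟦Γ⁻¹⟧^n-dependsOn-≥0 m = DependsOn-mono (λ {k} → subst (ℤ._≤ k) (cong +_ (ℕₚ.*-zeroʳ m)))
  (iter-dependsOn-≥ 0 (⟦Γ⁻¹⟧.dependsOn Γ⁻¹-keys) m)

⟦Γ⁻¹⟧⁸-dependsOn : DependsOn (iter 8 ⟦Γ⁻¹⟧) (Within (+ 0) (+ 16))
⟦Γ⁻¹⟧⁸-dependsOn = DependsOn-≗ (⟦Γ⁻¹⟧.iter≗power 8) (linCA-dependsOn (power Γ⁻¹ 8) Γ⁻⁸-keys)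

⟦Γ⁻¹⟧⁴≗id+⟦Γ⁻⁴+𝟙⟧ : ∀ c x → iter 4 ⟦Γ⁻¹⟧ c x ≡ c x ⊕ linCA Γ⁻⁴+𝟙 c x
⟦Γ⁻¹⟧⁴≗id+⟦Γ⁻⁴+𝟙⟧ c x = begin
  iter 4 ⟦Γ⁻¹⟧ c x
    ≡⟨ ⟦Γ⁻¹⟧.iter≗power 4 c x ⟩
  linCA (power Γ⁻¹ 4) c x
    ≡⟨ linCA-split (power Γ⁻¹ 4) 𝟙ᴸ c x ⟩
  linCA 𝟙ᴸ c x ⊕ linCA (normalise (power Γ⁻¹ 4 ++ 𝟙ᴸ)) c x
    ≡⟨ cong₂ (λ v L → v ⊕ linCA L c x) (linCA-𝟙ᴸ c x) (sym Γ⁻⁴+𝟙-definition) ⟩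
  c x ⊕ linCA Γ⁻⁴+𝟙 c x
    ∎
  where open ≡-Reasoning

⟦Γ⁻¹⟧¹²≗u¹⁶⟦Γ⁻¹⟧⁴+⟦Γ⁻¹²+u¹⁶Γ⁻⁴⟧ : ∀ c x →
  iter 12 ⟦Γ⁻¹⟧ c x ≡ iter 4 ⟦Γ⁻¹⟧ c (x ℤ.- + 16) ⊕ linCA Γ⁻¹²+u¹⁶Γ⁻⁴ c x
⟦Γ⁻¹⟧¹²≗u¹⁶⟦Γ⁻¹⟧⁴+⟦Γ⁻¹²+u¹⁶Γ⁻⁴⟧ c x = begin
  iter 12 ⟦Γ⁻¹⟧ c x
    ≡⟨ ⟦Γ⁻¹⟧.iter≗power 12 c x ⟩
  linCA (power Γ⁻¹ 12) c x
    ≡⟨ linCA-split (power Γ⁻¹ 12) (uᴸ (+ 16) ⋆ power Γ⁻¹ 4) c x ⟩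
  linCA (uᴸ (+ 16) ⋆ power Γ⁻¹ 4) c x ⊕ linCA (normalise (power Γ⁻¹ 12 ++ (uᴸ (+ 16) ⋆ power Γ⁻¹ 4))) c x
    ≡⟨ cong₂ (λ v L → v ⊕ linCA L c x) (sym u¹⁶F⁴) (sym Γ⁻¹²+u¹⁶Γ⁻⁴-definition) ⟩
  iter 4 ⟦Γ⁻¹⟧ c (x ℤ.- + 16) ⊕ linCA Γ⁻¹²+u¹⁶Γ⁻⁴ c x
    ∎
  where
  open ≡-Reasoning
  u¹⁶F⁴ : iter 4 ⟦Γ⁻¹⟧ c (x ℤ.- + 16) ≡ linCA (uᴸ (+ 16) ⋆ power Γ⁻¹ 4) c x
  u¹⁶F⁴ = begin
    iter 4 ⟦Γ⁻¹⟧ c (x ℤ.- + 16)                  ≡⟨ ⟦Γ⁻¹⟧.iter≗power 4 c (x ℤ.- + 16) ⟩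
    linCA (power Γ⁻¹ 4) c (x ℤ.- + 16)           ≡⟨ linCA-uᴸ (+ 16) (linCA (power Γ⁻¹ 4) c) x ⟨
    linCA (uᴸ (+ 16)) (linCA (power Γ⁻¹ 4) c) x  ≡⟨ linCA-⋆ (uᴸ (+ 16)) (power Γ⁻¹ 4) c x ⟩
    linCA (uᴸ (+ 16) ⋆ power Γ⁻¹ 4) c x          ∎

⟦Γ⁻¹⟧^[4+8j] : ∀ j → Σ (Op 3) λ R →
  (∀ c → iter (4 ℕ.+ 8 ℕ.* j) ⟦Γ⁻¹⟧ c ≗ shift (+ (16 ℕ.* j)) (iter 4 ⟦Γ⁻¹⟧ c) ⊕ᶜ R c)
  × DependsOn R (λ k → + 0 ℤ.≤ k × k ℤ.+ + 4 ℤ.≤ + (16 ℕ.* j))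
⟦Γ⁻¹⟧^[4+8j] zero = (λ c x → 𝟘) , F⁴≗ , (λ c c′ x agree → refl)
  where
  F⁴≗ : ∀ c x → iter 4 ⟦Γ⁻¹⟧ c x ≡ iter 4 ⟦Γ⁻¹⟧ c (x ℤ.- + 0) ⊕ 𝟘
  F⁴≗ c x = sym (trans (⊕-identityʳ _) (cong (iter 4 ⟦Γ⁻¹⟧ c) (ℤₚ.+-identityʳ x)))
⟦Γ⁻¹⟧^[4+8j] (suc j) with ⟦Γ⁻¹⟧^[4+8j] j
... | R , F^≗ , R-dep = R′ , F^≗′ , R′-dep
  where
  a = + (16 ℕ.* j)
  R′ : Op 3
  R′ c = shift a (linCA Γ⁻¹²+u¹⁶Γ⁻⁴ c) ⊕ᶜ iter 8 ⟦Γ⁻¹⟧ (R c)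
  F^≗′ : ∀ c x → iter (4 ℕ.+ 8 ℕ.* suc j) ⟦Γ⁻¹⟧ c x ≡ iter 4 ⟦Γ⁻¹⟧ c (x ℤ.- + (16 ℕ.* suc j)) ⊕ R′ c x
  F^≗′ c x = begin
    iter (4 ℕ.+ 8 ℕ.* suc j) ⟦Γ⁻¹⟧ c x                      ≡⟨ cong (λ n → iter n ⟦Γ⁻¹⟧ c x) (steps j) ⟩
    iter (8 ℕ.+ (4 ℕ.+ 8 ℕ.* j)) ⟦Γ⁻¹⟧ c x                  ≡⟨ cong (_$ x) (iter-+ ⟦Γ⁻¹⟧ 8 (4 ℕ.+ 8 ℕ.* j) c) ⟩
    iter 8 ⟦Γ⁻¹⟧ (iter (4 ℕ.+ 8 ℕ.* j) ⟦Γ⁻¹⟧ c) x           ≡⟨ iter-extensional ⟦Γ⁻¹⟧.extensional 8 (F^≗ c) x ⟩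
    iter 8 ⟦Γ⁻¹⟧ (shift a (iter 4 ⟦Γ⁻¹⟧ c) ⊕ᶜ R c) x        ≡⟨ iter-additive ⟦Γ⁻¹⟧.extensional ⟦Γ⁻¹⟧.additive 8 _ _ x ⟩
    iter 8 ⟦Γ⁻¹⟧ (shift a (iter 4 ⟦Γ⁻¹⟧ c)) x ⊕ r           ≡⟨ cong (_⊕ r) (⟦Γ⁻¹⟧.iter-shift 8 a _ x) ⟩
    iter 8 ⟦Γ⁻¹⟧ (iter 4 ⟦Γ⁻¹⟧ c) (x ℤ.- a) ⊕ r             ≡⟨ cong (λ c′ → c′ (x ℤ.- a) ⊕ r) (iter-+ ⟦Γ⁻¹⟧ 8 4 c) ⟨
    iter 12 ⟦Γ⁻¹⟧ c (x ℤ.- a) ⊕ r                           ≡⟨ cong (_⊕ r) (⟦Γ⁻¹⟧¹²≗u¹⁶⟦Γ⁻¹⟧⁴+⟦Γ⁻¹²+u¹⁶Γ⁻⁴⟧ c (x ℤ.- a)) ⟩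
    (iter 4 ⟦Γ⁻¹⟧ c y ⊕ linCA Γ⁻¹²+u¹⁶Γ⁻⁴ c (x ℤ.- a)) ⊕ r  ≡⟨ ⊕-assoc _ _ r ⟩
    iter 4 ⟦Γ⁻¹⟧ c y ⊕ R′ c x                               ≡⟨ cong (λ y → iter 4 ⟦Γ⁻¹⟧ c y ⊕ R′ c x) (offset x j) ⟩
    iter 4 ⟦Γ⁻¹⟧ c (x ℤ.- + (16 ℕ.* suc j)) ⊕ R′ c x        ∎
    where
    open ≡-Reasoning
    r = iter 8 ⟦Γ⁻¹⟧ (R c) x
    y = (x ℤ.- a) ℤ.- + 16
    steps : ∀ j → 4 ℕ.+ 8 ℕ.* suc j ≡ 8 ℕ.+ (4 ℕ.+ 8 ℕ.* j)
    steps = ℕsolve-∀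
    offset : ∀ x j → (x ℤ.- + (16 ℕ.* j)) ℤ.- + 16 ≡ x ℤ.- + (16 ℕ.* suc j)
    offset x j = trans (sym (sub-sub x _ (+ 16)))
                       (cong (λ n → x ℤ.- + n) (trans (ℕₚ.+-comm (16 ℕ.* j) 16) (sym (ℕₚ.*-suc 16 j))))
  R′-dep : DependsOn R′ (λ k → + 0 ℤ.≤ k × k ℤ.+ + 4 ℤ.≤ + (16 ℕ.* suc j))
  R′-dep = DependsOn-mono window
    (DependsOn-⊕ᶜ (DependsOn-∘ (shift-dependsOn a) (linCA-dependsOn _ Γ⁻¹²+u¹⁶Γ⁻⁴-keys))
                   (DependsOn-∘ ⟦Γ⁻¹⟧⁸-dependsOn R-dep))
    where
    open ℤₚ.≤-Reasoning
    16[j+1] : + (16 ℕ.* j) ℤ.+ + 16 ≡ + (16 ℕ.* suc j)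
    16[j+1] = cong +_ (trans (ℕₚ.+-comm (16 ℕ.* j) 16) (sym (ℕₚ.*-suc 16 j)))
    window : ∀ {k} → _ → + 0 ℤ.≤ k × k ℤ.+ + 4 ℤ.≤ + (16 ℕ.* suc j)
    window (inj₁ (a , k , refl , (0≤k , k≤12) , refl)) = ℤₚ.+-mono-≤ (ℤ.+≤+ ℕ.z≤n) 0≤k , (begin
      (a ℤ.+ k) ℤ.+ + 4  ≡⟨ ℤₚ.+-assoc a k (+ 4) ⟩
      a ℤ.+ (k ℤ.+ + 4)  ≤⟨ ℤₚ.+-monoʳ-≤ a (ℤₚ.+-monoˡ-≤ (+ 4) k≤12) ⟩
      a ℤ.+ + 16         ≡⟨ 16[j+1] ⟩
      + (16 ℕ.* suc j)   ∎)
    window (inj₂ (i , k , (0≤i , i≤16) , (0≤k , k+4≤16j) , refl)) = ℤₚ.+-mono-≤ 0≤i 0≤k , (begin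
      (i ℤ.+ k) ℤ.+ + 4  ≡⟨ ℤₚ.+-assoc i k (+ 4) ⟩
      i ℤ.+ (k ℤ.+ + 4)  ≤⟨ ℤₚ.+-mono-≤ i≤16 k+4≤16j ⟩
      + 16 ℤ.+ a         ≡⟨ ℤₚ.+-comm (+ 16) a ⟩
      a ℤ.+ + 16         ≡⟨ 16[j+1] ⟩
      + (16 ℕ.* suc j)   ∎)

Γ^[2^M-4-8j]-decomposition : ∀ M j → 4 ℕ.+ 8 ℕ.* j ℕ.≤ 2 ℕ.^ M → 16 ℕ.* j ℕ.+ 2 ℕ.≤ (2 ℕ.^ M ℕ./ 3) ℕ.* 2 →
  Decomposition Γ (2 ℕ.^ M ℕ.∸ (4 ℕ.+ 8 ℕ.* j)) (+ (16 ℕ.* j)) 1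
Γ^[2^M-4-8j]-decomposition M j m≤S 16j+2≤2⌊S/3⌋ with ⟦Γ⁻¹⟧^[4+8j] j
... | Rⱼ , F^m≗ , Rⱼ-dep = R , Γ^n≗ , R-dep
  where
  m = 4 ℕ.+ 8 ℕ.* j
  S = 2 ℕ.^ M
  n = S ℕ.∸ m
  a = + (16 ℕ.* j)
  D = linCA Γ⁻⁴+𝟙
  R : Op 3
  R c = (shift a (D c) ⊕ᶜ Rⱼ c) ⊕ᶜ iter m ⟦Γ⁻¹⟧ (iter S ⟦Γ+𝟙⟧ c)
  Γ^n≗ : ∀ c x → iter n Γ c x ≡ c (x ℤ.- a) ⊕ R c x
  Γ^n≗ c x = begin
    iter n Γ c x                                  ≡⟨ iter-cancel ⟦Γ⁻¹⟧.extensional ⟦Γ⁻¹⟧∘Γ≗id m n c x ⟨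
    iter m ⟦Γ⁻¹⟧ (iter (m ℕ.+ n) Γ c) x           ≡⟨ cong (λ k → iter m ⟦Γ⁻¹⟧ (iter k Γ c) x) (ℕₚ.m+[n∸m]≡n m≤S) ⟩
    iter m ⟦Γ⁻¹⟧ (iter S Γ c) x                   ≡⟨ iter-extensional ⟦Γ⁻¹⟧.extensional m (Γ^2^≗id+⟦Γ+𝟙⟧^2^ M c) x ⟩
    iter m ⟦Γ⁻¹⟧ (c ⊕ᶜ iter S ⟦Γ+𝟙⟧ c) x          ≡⟨ iter-additive ⟦Γ⁻¹⟧.extensional ⟦Γ⁻¹⟧.additive m c _ x ⟩
    iter m ⟦Γ⁻¹⟧ c x ⊕ e                          ≡⟨ cong (_⊕ e) (F^m≗ c x) ⟩
    (iter 4 ⟦Γ⁻¹⟧ c (x ℤ.- a) ⊕ Rⱼ c x) ⊕ e       ≡⟨ cong (λ v → (v ⊕ Rⱼ c x) ⊕ e) (⟦Γ⁻¹⟧⁴≗id+⟦Γ⁻⁴+𝟙⟧ c (x ℤ.- a)) ⟩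
    ((c (x ℤ.- a) ⊕ D c (x ℤ.- a)) ⊕ Rⱼ c x) ⊕ e  ≡⟨ cong (_⊕ e) (⊕-assoc _ _ _) ⟩
    (c (x ℤ.- a) ⊕ (D c (x ℤ.- a) ⊕ Rⱼ c x)) ⊕ e  ≡⟨ ⊕-assoc _ _ _ ⟩
    c (x ℤ.- a) ⊕ R c x                           ∎
    where
    open ≡-Reasoning
    e = iter m ⟦Γ⁻¹⟧ (iter S ⟦Γ+𝟙⟧ c) x
  R-dep : DependsOn R (Outside a 1)
  R-dep = DependsOn-mono outside
    (DependsOn-⊕ᶜ (DependsOn-⊕ᶜ (DependsOn-∘ (shift-dependsOn a) (linCA-dependsOn _ Γ⁻⁴+𝟙-keys)) Rⱼ-dep)
                  (DependsOn-∘ (⟦Γ⁻¹⟧^n-dependsOn-≥0 m) (⟦Γ+𝟙⟧^n-dependsOn S)))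
    where
    open ℤₚ.≤-Reasoning
    outside : ∀ {k} → _ → Outside a 1 k
    outside (inj₁ (inj₁ (a , k , refl , (2≤k , _) , refl))) = inj₂ (ℤₚ.+-monoʳ-≤ a 2≤k)
    outside {k} (inj₁ (inj₂ (_ , k+4≤a)))                     =
      inj₁ (ℤₚ.≤-trans (ℤₚ.+-monoʳ-≤ k (ℤ.+≤+ {2} {4} (ℕ.s≤s (ℕ.s≤s ℕ.z≤n)))) k+4≤a)
    outside (inj₂ (i , k , 0≤i , 2⌊S/3⌋≤k , refl))            = inj₂ (begin
      a ℤ.+ + 2          ≤⟨ ℤ.+≤+ 16j+2≤2⌊S/3⌋ ⟩
      + (S ℕ./ 3 ℕ.* 2)  ≤⟨ 2⌊S/3⌋≤k ⟩
      k                  ≡⟨ ℤₚ.+-identityˡ k ⟨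
      + 0 ℤ.+ k          ≤⟨ ℤₚ.+-monoˡ-≤ k 0≤i ⟩
      i ℤ.+ k            ∎)

⟦Γ₂⟧-dilates : ∀ c e h → ⟦Γ₂⟧ c (e ℤ.+ h ℤ.* + 2) ≡ Γ (coset c e) h
⟦Γ₂⟧-dilates c e h = trans (⟦Γ₂⟧-definition c _) (linCA-dilate ΓMat c e h)

Γ²∘⟦Π⟧≗⟦Π⟧∘⟦Γ₂⟧ : ∀ c → iter 2 Γ (⟦Π⟧ c) ≗ ⟦Π⟧ (⟦Γ₂⟧ c)
Γ²∘⟦Π⟧≗⟦Π⟧∘⟦Γ₂⟧ c x = begin
  Γ (Γ (⟦Π⟧ c)) x
    ≡⟨ Γ.extensional (Γ.extensional (⟦Π⟧-definition c)) x ⟩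
  Γ (Γ (linCA Π c)) x
    ≡⟨ Γ.extensional (linCA-⋆ ΓMat Π c) x ⟩
  Γ (linCA (ΓMat ⋆ Π) c) x
    ≡⟨ linCA-⋆ ΓMat (ΓMat ⋆ Π) c x ⟩
  linCA (ΓMat ⋆ (ΓMat ⋆ Π)) c x
    ≡⟨ linCA-≗-by-normalise (ΓMat ⋆ (ΓMat ⋆ Π)) (Π ⋆ dilate ΓMat) Π-conjugation-certificate c x ⟩
  linCA (Π ⋆ dilate ΓMat) c x
    ≡⟨ linCA-⋆ Π (dilate ΓMat) c x ⟨
  linCA Π (linCA (dilate ΓMat) c) x
    ≡⟨ linCA-extensional Π (⟦Γ₂⟧-definition c) x ⟨
  linCA Π (⟦Γ₂⟧ c) x
    ≡⟨ ⟦Π⟧-definition _ x ⟨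
  ⟦Π⟧ (⟦Γ₂⟧ c) x
    ∎
  where open ≡-Reasoning

⟦Π⟧∘⟦Π⁻¹⟧≗id : ∀ c → ⟦Π⟧ (⟦Π⁻¹⟧ c) ≗ c
⟦Π⟧∘⟦Π⁻¹⟧≗id c x = begin
  ⟦Π⟧ (⟦Π⁻¹⟧ c) x          ≡⟨ ⟦Π⟧-definition _ x ⟩
  linCA Π (⟦Π⁻¹⟧ c) x      ≡⟨ linCA-extensional Π (⟦Π⁻¹⟧-definition c) x ⟩
  linCA Π (linCA Π⁻¹ c) x  ≡⟨ linCA-⋆ Π Π⁻¹ c x ⟩
  linCA (Π ⋆ Π⁻¹) c x      ≡⟨ linCA-≗-by-normalise (Π ⋆ Π⁻¹) 𝟙ᴸ Π⁻¹-certificate c x ⟩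
  linCA 𝟙ᴸ c x             ≡⟨ linCA-𝟙ᴸ c x ⟩
  c x                      ∎
  where open ≡-Reasoning

Γ-decomposition-conjugate : ∀ {y b m} → Decomposition ⟦Γ₂⟧ y b (suc m) → Decomposition Γ (y ℕ.* 2) b m
Γ-decomposition-conjugate {y} {b} {m} (R₂ , ⟦Γ₂⟧^y≗ , R₂-dep) = R , Γ^2y≗ , R-dep
  where
  R : Op 3
  R c = ⟦Π⟧ (R₂ (⟦Π⁻¹⟧ c))
  Γ^2y≗ : ∀ c x → iter (y ℕ.* 2) Γ c x ≡ c (x ℤ.- b) ⊕ R c x
  Γ^2y≗ c x = begin
    iter (y ℕ.* 2) Γ c x
      ≡⟨ iter-extensional Γ.extensional (y ℕ.* 2) (⟦Π⟧∘⟦Π⁻¹⟧≗id c) x ⟨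
    iter (y ℕ.* 2) Γ (⟦Π⟧ c′) x
      ≡⟨ cong (_$ x) (iter-* Γ y 2 (⟦Π⟧ c′)) ⟩
    iter y (iter 2 Γ) (⟦Π⟧ c′) x
      ≡⟨ iter-intertwine {K₂ = ⟦Γ₂⟧} {⟦Π⟧} (iter-extensional Γ.extensional 2) Γ²∘⟦Π⟧≗⟦Π⟧∘⟦Γ₂⟧ y c′ x ⟩
    ⟦Π⟧ (iter y ⟦Γ₂⟧ c′) x
      ≡⟨ ⟦Π⟧.extensional (⟦Γ₂⟧^y≗ c′) x ⟩
    ⟦Π⟧ (shift b c′ ⊕ᶜ R₂ c′) x
      ≡⟨ ⟦Π⟧.additive (shift b c′) (R₂ c′) x ⟩
    ⟦Π⟧ (shift b c′) x ⊕ R c x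
      ≡⟨ cong (_⊕ R c x) (⟦Π⟧.shift-commute b c′ x) ⟩
    ⟦Π⟧ c′ (x ℤ.- b) ⊕ R c x
      ≡⟨ cong (_⊕ R c x) (⟦Π⟧∘⟦Π⁻¹⟧≗id c (x ℤ.- b)) ⟩
    c (x ℤ.- b) ⊕ R c x
      ∎
    where
    open ≡-Reasoning
    c′ = ⟦Π⁻¹⟧ c
  R-dep : DependsOn R (Outside b m)
  R-dep = DependsOn-mono outside
    (DependsOn-∘ (⟦Π⟧.dependsOn Π-keys) (DependsOn-∘ R₂-dep (⟦Π⁻¹⟧.dependsOn Π⁻¹-keys)))
    where
    open ℤₚ.≤-Reasoning
    outside : ∀ {k} → (Within (+ 0) (+ 1) +ˢ (Outside b (suc m) +ˢ Within (ℤ.- + 1) (+ 0))) k → Outside b m k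
    outside (i , _ , (0≤i , i≤1) , (k , l , inj₁ k+m+2≤b , (-1≤l , l≤0) , refl) , refl) = inj₁ (begin
      (i ℤ.+ (k ℤ.+ l)) ℤ.+ + suc m      ≤⟨ ℤₚ.+-monoˡ-≤ (+ suc m) (ℤₚ.+-mono-≤ i≤1 (ℤₚ.+-monoʳ-≤ k l≤0)) ⟩
      (+ 1 ℤ.+ (k ℤ.+ + 0)) ℤ.+ + suc m  ≡⟨ regroup k (+ m) ⟩
      k ℤ.+ + suc (suc m)                ≤⟨ k+m+2≤b ⟩
      b                                  ∎)
      where
      regroup : ∀ k m → (+ 1 ℤ.+ (k ℤ.+ + 0)) ℤ.+ (+ 1 ℤ.+ m) ≡ k ℤ.+ (+ 1 ℤ.+ (+ 1 ℤ.+ m))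
      regroup = ℤsolve-∀
    outside (i , _ , (0≤i , i≤1) , (k , l , inj₂ b+m+2≤k , (-1≤l , l≤0) , refl) , refl) = inj₂ (begin
      b ℤ.+ + suc m                      ≡⟨ regroup b (+ m) ⟩
      (b ℤ.+ + suc (suc m)) ℤ.+ ℤ.- + 1  ≤⟨ ℤₚ.+-monoˡ-≤ (ℤ.- + 1) b+m+2≤k ⟩
      k ℤ.+ ℤ.- + 1                      ≡⟨ ℤₚ.+-identityˡ _ ⟨
      + 0 ℤ.+ (k ℤ.+ ℤ.- + 1)            ≤⟨ ℤₚ.+-mono-≤ 0≤i (ℤₚ.+-monoʳ-≤ k -1≤l) ⟩
      i ℤ.+ (k ℤ.+ l)                    ∎)
      where
      regroup : ∀ b m → b ℤ.+ (+ 1 ℤ.+ m) ≡ (b ℤ.+ (+ 1 ℤ.+ (+ 1 ℤ.+ m))) ℤ.+ ℤ.- + 1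
      regroup = ℤsolve-∀

Γ-decomposition-double : ∀ {y a l} → Decomposition Γ y a l → Decomposition Γ (y ℕ.* 2) (a ℤ.+ a) (l ℕ.+ l)
Γ-decomposition-double {y} =
  Γ-decomposition-conjugate {y} ∘ decomposition-dilate {H₂ = ⟦Γ₂⟧} Γ.extensional ⟦Γ₂⟧-dilates {y}

Γ-decomposition-2^ : ∀ {y A l} → Decomposition Γ y (+ A) l →
  ∀ s → Decomposition Γ (y ℕ.* 2 ℕ.^ s) (+ (A ℕ.* 2 ℕ.^ s)) (l ℕ.* 2 ℕ.^ s)
Γ-decomposition-2^ {y} {A} {l} dec zero =
  subst₂ (λ y′ A′ → Decomposition Γ y′ (+ A′) (l ℕ.* 1)) (sym (ℕₚ.*-identityʳ y)) (sym (ℕₚ.*-identityʳ A))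
    (subst (Decomposition Γ y (+ A)) (sym (ℕₚ.*-identityʳ l)) dec)
Γ-decomposition-2^ {y} {A} {l} dec (suc s) =
  subst (λ y′ → Decomposition Γ y′ (+ (A ℕ.* 2 ℕ.^ suc s)) (l ℕ.* 2 ℕ.^ suc s)) (twice y)
  (subst (λ A′ → Decomposition Γ (y ℕ.* 2 ℕ.^ s ℕ.* 2) (+ A′) (l ℕ.* 2 ℕ.^ suc s)) (doubled A)
  (subst (Decomposition Γ (y ℕ.* 2 ℕ.^ s ℕ.* 2) (+ (A ℕ.* 2 ℕ.^ s ℕ.+ A ℕ.* 2 ℕ.^ s))) (doubled l)
    (Γ-decomposition-double {y ℕ.* 2 ℕ.^ s} (Γ-decomposition-2^ {y} dec s))))
  where
  twice : ∀ n → n ℕ.* 2 ℕ.^ s ℕ.* 2 ≡ n ℕ.* (2 ℕ.* 2 ℕ.^ s)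
  twice n = regroup n (2 ℕ.^ s)
    where
    regroup : ∀ n x → n ℕ.* x ℕ.* 2 ≡ n ℕ.* (2 ℕ.* x)
    regroup = ℕsolve-∀
  doubled : ∀ n → n ℕ.* 2 ℕ.^ s ℕ.+ n ℕ.* 2 ℕ.^ s ≡ n ℕ.* (2 ℕ.* 2 ℕ.^ s)
  doubled n = regroup n (2 ℕ.^ s)
    where
    regroup : ∀ n x → n ℕ.* x ℕ.+ n ℕ.* x ≡ n ℕ.* (2 ℕ.* x)
    regroup = ℕsolve-∀

-- Points of X₂(Γ) near the segment

toℚᵘ-/ : ∀ i n .{{_ : ℕ.NonZero n}} → toℚᵘ (i ℚ./ n) ℚᵘ.≃ (i ℚᵘ./ n)
toℚᵘ-/ i (suc n) = ℚₚ.toℚᵘ-fromℚᵘ (mkℚᵘ i n)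

toℚ-scale : ∀ A S T .{{_ : ℕ.NonZero S}} → toℚ (+ (A ℕ.* T)) ≡ ((+ A) ℚ./ S) ℚ.* toℚ (+ (S ℕ.* T))
toℚ-scale A S@(suc S′) T = ℚₚ.toℚᵘ-injective (begin
  toℚᵘ (toℚ (+ (A ℕ.* T)))                          ≈⟨ toℚᵘ-/ (+ (A ℕ.* T)) 1 ⟩
  (+ (A ℕ.* T)) ℚᵘ./ 1                              ≈⟨ *≡* cross-multiplied ⟩
  ((+ A) ℚᵘ./ S) ℚᵘ.* ((+ (S ℕ.* T)) ℚᵘ./ 1)        ≈⟨ ℚᵘₚ.*-cong (toℚᵘ-/ (+ A) S) (toℚᵘ-/ (+ (S ℕ.* T)) 1) ⟨
  toℚᵘ ((+ A) ℚ./ S) ℚᵘ.* toℚᵘ (toℚ (+ (S ℕ.* T)))  ≈⟨ ℚₚ.toℚᵘ-homo-* ((+ A) ℚ./ S) (toℚ (+ (S ℕ.* T))) ⟨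
  toℚᵘ (((+ A) ℚ./ S) ℚ.* toℚ (+ (S ℕ.* T)))        ∎)
  where
  open ℚᵘₚ.≃-Reasoning
  cross-multiplied : + (A ℕ.* T) ℤ.* + (S ℕ.* 1) ≡ (+ A ℤ.* + (S ℕ.* T)) ℤ.* + 1
  cross-multiplied =
    trans (sym (ℤₚ.pos-* (A ℕ.* T) (S ℕ.* 1)))
    (trans (cong +_ (regroup A T S))
    (trans (ℤₚ.pos-* (A ℕ.* (S ℕ.* T)) 1) (cong (ℤ._* + 1) (ℤₚ.pos-* A (S ℕ.* T)))))
    where
    regroup : ∀ A T S → A ℕ.* T ℕ.* (S ℕ.* 1) ≡ A ℕ.* (S ℕ.* T) ℕ.* 1
    regroup = ℕsolve-∀

X-point : ∀ M j → 4 ℕ.+ 8 ℕ.* j ℕ.≤ 2 ℕ.^ M → 16 ℕ.* j ℕ.+ 2 ℕ.≤ (2 ℕ.^ M ℕ./ 3) ℕ.* 2 →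
  X Γ 2 (((+ (16 ℕ.* j)) ℚ./ 2 ℕ.^ M) {{ℕₚ.m^n≢0 2 M}})
        (((+ (2 ℕ.^ M ℕ.∸ (4 ℕ.+ 8 ℕ.* j))) ℚ./ 2 ℕ.^ M) {{ℕₚ.m^n≢0 2 M}})
X-point M j m≤S 16j+2≤2⌊S/3⌋ = M , M , λ n M≤n →
  let s = n ℕ.∸ M
      2^M*2^s≡2^n : 2 ℕ.^ M ℕ.* 2 ℕ.^ s ≡ 2 ℕ.^ n
      2^M*2^s≡2^n = trans (sym (ℕₚ.^-distribˡ-+-* 2 M s)) (cong (2 ℕ.^_) (ℕₚ.m+[n∸m]≡n M≤n))
      scaled : ∀ A → toℚ (+ (A ℕ.* 2 ℕ.^ s)) ≡ (((+ A) ℚ./ 2 ℕ.^ M) {{ℕₚ.m^n≢0 2 M}}) ℚ.* toℚ (+ (2 ℕ.^ n))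
      scaled A = trans (toℚ-scale A (2 ℕ.^ M) (2 ℕ.^ s) {{ℕₚ.m^n≢0 2 M}})
                       (cong (λ k → (((+ A) ℚ./ 2 ℕ.^ M) {{ℕₚ.m^n≢0 2 M}}) ℚ.* toℚ (+ k)) 2^M*2^s≡2^n)
      a = + (16 ℕ.* j ℕ.* 2 ℕ.^ s)
      b = (2 ℕ.^ M ℕ.∸ (4 ℕ.+ 8 ℕ.* j)) ℕ.* 2 ℕ.^ s
  in a , b , scaled (16 ℕ.* j) , scaled (2 ℕ.^ M ℕ.∸ (4 ℕ.+ 8 ℕ.* j)) ,
     subst (λ l → P Γ a b l l) (ℕₚ.*-identityˡ (2 ℕ.^ s))
       (decomposition⇒P {H = Γ} {b}
         (Γ-decomposition-2^ {2 ℕ.^ M ℕ.∸ (4 ℕ.+ 8 ℕ.* j)} (Γ^[2^M-4-8j]-decomposition M j m≤S 16j+2≤2⌊S/3⌋) s))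

∣p-q∣<-by-fractions : ∀ {p q : ℚ} (a b : ℤ) (m n : ℕ) .{{_ : ℕ.NonZero m}} .{{_ : ℕ.NonZero n}}
                      {E e} .{c : Coprime E (suc e)} →
  toℚᵘ p ℚᵘ.≃ a ℚᵘ./ m → toℚᵘ q ℚᵘ.≃ b ℚᵘ./ n →
  ℤ.∣ a ℤ.* + n ℤ.- b ℤ.* + m ∣ ℕ.* suc e ℕ.< E ℕ.* (m ℕ.* n) →
  ℚ.∣ p ℚ.- q ∣ ℚ.< mkℚ (+ E) e c
∣p-q∣<-by-fractions {p} {q} a b m@(suc _) n@(suc _) {E} {e} p≃a/m q≃b/n small =
  ℚₚ.toℚᵘ-cancel-< (ℚᵘₚ.<-respˡ-≃ (ℚᵘₚ.≃-sym ∣p-q∣≃) (*<* cross-multiplied))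
  where
  N = a ℤ.* + n ℤ.- b ℤ.* + m
  ∣p-q∣≃ : toℚᵘ (ℚ.∣ p ℚ.- q ∣) ℚᵘ.≃ (+ ℤ.∣ N ∣) ℚᵘ./ (m ℕ.* n)
  ∣p-q∣≃ = begin
    toℚᵘ (ℚ.∣ p ℚ.- q ∣)
      ≈⟨ ℚₚ.toℚᵘ-homo-∣-∣ (p ℚ.- q) ⟩
    ℚᵘ.∣ toℚᵘ (p ℚ.- q) ∣
      ≈⟨ ℚᵘₚ.∣-∣-cong (ℚₚ.toℚᵘ-homo-+ p (ℚ.- q)) ⟩
    ℚᵘ.∣ toℚᵘ p ℚᵘ.+ toℚᵘ (ℚ.- q) ∣
      ≈⟨ ℚᵘₚ.∣-∣-cong (ℚᵘₚ.+-cong p≃a/m (ℚᵘₚ.≃-trans (ℚₚ.toℚᵘ-homo‿- q) (ℚᵘₚ.-‿cong q≃b/n))) ⟩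
    ℚᵘ.∣ (a ℚᵘ./ m) ℚᵘ.- (b ℚᵘ./ n) ∣
      ≡⟨ cong (λ k → (+ ℤ.∣ a ℤ.* + n ℤ.+ k ∣) ℚᵘ./ (m ℕ.* n)) (ℤₚ.neg-distribˡ-* b (+ m)) ⟨
    (+ ℤ.∣ N ∣) ℚᵘ./ (m ℕ.* n)
      ∎
    where open ℚᵘₚ.≃-Reasoning
  cross-multiplied : + ℤ.∣ N ∣ ℤ.* + suc e ℤ.< + E ℤ.* + (m ℕ.* n)
  cross-multiplied = subst₂ ℤ._<_ (ℤₚ.pos-* ℤ.∣ N ∣ (suc e)) (ℤₚ.pos-* E (m ℕ.* n)) (ℤ.+<+ small)

∣+m-+n∣≡∣m-n∣ : ∀ m n → ℤ.∣ + m ℤ.- + n ∣ ≡ ℕ.∣ m - n ∣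
∣+m-+n∣≡∣m-n∣ m n with ℕₚ.≤-total n m
... | inj₁ n≤m = trans (cong ℤ.∣_∣ (trans (ℤₚ.m-n≡m⊖n m n) (ℤₚ.⊖-≥ n≤m))) (sym (ℕₚ.m≤n⇒∣n-m∣≡n∸m n≤m))
... | inj₂ m≤n = trans (cong ℤ.∣_∣ (ℤₚ.m-n≡m⊖n m n)) (trans (ℤₚ.∣⊖∣-≤ m≤n) (sym (ℕₚ.m≤n⇒∣m-n∣≡n∸m m≤n)))

n<2^n : ∀ n → n ℕ.< 2 ℕ.^ n
n<2^n zero    = ℕ.s≤s ℕ.z≤n
n<2^n (suc n) = ℕₚ.≤-trans (ℕₚ.≤-reflexive (ℕₚ.+-comm 1 (suc n)))
                           (ℕₚ.+-mono-≤ (n<2^n n) (ℕₚ.≤-trans (ℕₚ.m^n>0 2 n) (ℕₚ.m≤m+n (2 ℕ.^ n) 0)))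

2^[k+6]-bounds : ∀ k → 64 ℕ.≤ 2 ℕ.^ (k ℕ.+ 6) × 20 ℕ.* k ℕ.≤ 2 ℕ.^ (k ℕ.+ 6)
2^[k+6]-bounds k = subst (64 ℕ.≤_) (sym 2^[k+6]≡) (ℕₚ.*-monoˡ-≤ 64 (ℕₚ.m^n>0 2 k))
                 , subst (20 ℕ.* k ℕ.≤_) (sym 2^[k+6]≡) (begin
                     20 ℕ.* k        ≤⟨ ℕₚ.*-monoˡ-≤ k (ℕₚ.m≤m+n 20 44) ⟩
                     64 ℕ.* k        ≤⟨ ℕₚ.*-monoʳ-≤ 64 (ℕₚ.<⇒≤ (n<2^n k)) ⟩
                     64 ℕ.* 2 ℕ.^ k  ≡⟨ ℕₚ.*-comm 64 (2 ℕ.^ k) ⟩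
                     2 ℕ.^ k ℕ.* 64  ∎)
  where
  open ℕₚ.≤-Reasoning
  2^[k+6]≡ : 2 ℕ.^ (k ℕ.+ 6) ≡ 2 ℕ.^ k ℕ.* 64
  2^[k+6]≡ = ℕₚ.^-distribˡ-+-* 2 k 6

gap-scaled : ∀ D T S e E → D ℕ.< 60 ℕ.* T → 20 ℕ.* suc e ℕ.≤ S → D ℕ.* suc e ℕ.< suc E ℕ.* (S ℕ.* (T ℕ.* 3))
gap-scaled D T S e E D<60T 20[1+e]≤S = begin-strict
  D ℕ.* suc e                  <⟨ ℕₚ.*-monoˡ-< (suc e) D<60T ⟩
  60 ℕ.* T ℕ.* suc e           ≡⟨ regroup T (suc e) ⟩
  T ℕ.* 3 ℕ.* (20 ℕ.* suc e)   ≤⟨ ℕₚ.*-monoʳ-≤ (T ℕ.* 3) 20[1+e]≤S ⟩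
  T ℕ.* 3 ℕ.* S                ≡⟨ ℕₚ.*-comm (T ℕ.* 3) S ⟩
  S ℕ.* (T ℕ.* 3)              ≤⟨ ℕₚ.m≤m*n (S ℕ.* (T ℕ.* 3)) (suc E) ⟩
  S ℕ.* (T ℕ.* 3) ℕ.* suc E    ≡⟨ ℕₚ.*-comm (S ℕ.* (T ℕ.* 3)) (suc E) ⟩
  suc E ℕ.* (S ℕ.* (T ℕ.* 3))  ∎
  where
  open ℕₚ.≤-Reasoning
  regroup : ∀ T e → 60 ℕ.* T ℕ.* e ≡ T ℕ.* 3 ℕ.* (20 ℕ.* e)
  regroup = ℕsolve-∀

numerator≤denominator : ∀ {n d} .{c : Coprime n (suc d)} → mkℚ (+ n) d c ℚ.≤ 1ℚ → n ℕ.≤ suc d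
numerator≤denominator {n} {d} (ℚ.*≤* n*1≤1*d) = subst₂ ℕ._≤_ (ℕₚ.*-identityʳ n) (ℕₚ.*-identityˡ (suc d))
  (ℤₚ.drop‿+≤+ (subst₂ ℤ._≤_ (sym (ℤₚ.pos-* n 1)) (sym (ℤₚ.pos-* 1 (suc d))) n*1≤1*d))

module Approximation (tn td S : ℕ) (tn≤T : tn ℕ.≤ suc td) (64≤S : 64 ℕ.≤ S) where
  private
    T = suc td
    Q = S ℕ./ 3
    s = S ℕ.% 3
    Q′ = Q ℕ.∸ 1
    r = (tn ℕ.* Q′) ℕ.% (8 ℕ.* T)

  -- 8j ≈ tQ′ with Q′ = ⌊S/3⌋ - 1: then 16j/S ≈ 2t/3, and the -1 keeps 16j + 2 ≤ 2⌊S/3⌋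
  j : ℕ
  j = (tn ℕ.* Q′) ℕ./ (8 ℕ.* T)

  private
    open ℕₚ.≤-Reasoning

    s≤2 : s ℕ.≤ 2
    s≤2 = ℕₚ.≤-pred (ℕDivMod.m%n<n S 3)

    r<8T : r ℕ.< 8 ℕ.* T
    r<8T = ℕDivMod.m%n<n (tn ℕ.* Q′) (8 ℕ.* T)

    2≤Q : 2 ℕ.≤ Q
    2≤Q = ℕₚ.≮⇒≥ λ Q<2 → ℕₚ.<⇒≱ (ℕ.s≤s (ℕ.s≤s (ℕ.s≤s (ℕ.s≤s (ℕ.s≤s (ℕ.s≤s ℕ.z≤n)))))) (begin
      64             ≤⟨ 64≤S ⟩
      S              ≡⟨ ℕDivMod.m≡m%n+[m/n]*n S 3 ⟩
      s ℕ.+ Q ℕ.* 3  ≤⟨ ℕₚ.+-mono-≤ s≤2 (ℕₚ.*-monoˡ-≤ 3 (ℕₚ.≤-pred Q<2)) ⟩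
      5              ∎)

    Q≡1+Q′ : Q ≡ suc Q′
    Q≡1+Q′ = sym (ℕₚ.m+[n∸m]≡n (ℕₚ.≤-trans (ℕ.s≤s ℕ.z≤n) 2≤Q))

    S≡ : S ≡ s ℕ.+ suc Q′ ℕ.* 3
    S≡ = trans (ℕDivMod.m≡m%n+[m/n]*n S 3) (cong (λ q → s ℕ.+ q ℕ.* 3) Q≡1+Q′)

    tnQ′≡ : tn ℕ.* Q′ ≡ r ℕ.+ j ℕ.* (8 ℕ.* T)
    tnQ′≡ = ℕDivMod.m≡m%n+[m/n]*n (tn ℕ.* Q′) (8 ℕ.* T)

    8j≤Q′ : 8 ℕ.* j ℕ.≤ Q′
    8j≤Q′ = ℕₚ.*-cancelʳ-≤ (8 ℕ.* j) Q′ T (begin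
      8 ℕ.* j ℕ.* T    ≡⟨ ℕₚ.*-assoc 8 j T ⟩
      8 ℕ.* (j ℕ.* T)  ≡⟨ cong (8 ℕ.*_) (ℕₚ.*-comm j T) ⟩
      8 ℕ.* (T ℕ.* j)  ≡⟨ ℕₚ.*-assoc 8 T j ⟨
      8 ℕ.* T ℕ.* j    ≡⟨ ℕₚ.*-comm (8 ℕ.* T) j ⟩
      j ℕ.* (8 ℕ.* T)  ≤⟨ ℕDivMod.m/n*n≤m (tn ℕ.* Q′) (8 ℕ.* T) ⟩
      tn ℕ.* Q′        ≤⟨ ℕₚ.*-monoˡ-≤ Q′ tn≤T ⟩
      T ℕ.* Q′         ≡⟨ ℕₚ.*-comm T Q′ ⟩
      Q′ ℕ.* T         ∎)

  4+8j≤S : 4 ℕ.+ 8 ℕ.* j ℕ.≤ S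
  4+8j≤S = begin
    4 ℕ.+ 8 ℕ.* j  ≤⟨ ℕₚ.+-monoʳ-≤ 4 (ℕₚ.≤-trans 8j≤Q′ (ℕₚ.m∸n≤m Q 1)) ⟩
    2 ℕ.* 2 ℕ.+ Q  ≤⟨ ℕₚ.+-monoˡ-≤ Q (ℕₚ.*-monoʳ-≤ 2 2≤Q) ⟩
    2 ℕ.* Q ℕ.+ Q  ≡⟨ regroup Q ⟩
    Q ℕ.* 3        ≤⟨ ℕDivMod.m/n*n≤m S 3 ⟩
    S              ∎
    where
    regroup : ∀ q → 2 ℕ.* q ℕ.+ q ≡ q ℕ.* 3
    regroup = ℕsolve-∀

  16j+2≤2⌊S/3⌋ : 16 ℕ.* j ℕ.+ 2 ℕ.≤ (S ℕ./ 3) ℕ.* 2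
  16j+2≤2⌊S/3⌋ = begin
    16 ℕ.* j ℕ.+ 2         ≡⟨ cong (ℕ._+ 2) (ℕₚ.*-assoc 2 8 j) ⟩
    2 ℕ.* (8 ℕ.* j) ℕ.+ 2  ≤⟨ ℕₚ.+-monoˡ-≤ 2 (ℕₚ.*-monoʳ-≤ 2 8j≤Q′) ⟩
    2 ℕ.* Q′ ℕ.+ 2         ≡⟨ regroup Q′ ⟩
    suc Q′ ℕ.* 2           ≡⟨ cong (ℕ._* 2) Q≡1+Q′ ⟨
    Q ℕ.* 2                ∎
    where
    regroup : ∀ q → 2 ℕ.* q ℕ.+ 2 ≡ suc q ℕ.* 2
    regroup = ℕsolve-∀

  private
    expand : ∀ k → tn ℕ.* k ℕ.* S ≡ k ℕ.* (tn ℕ.* (s ℕ.+ 3)) ℕ.+ 3 ℕ.* k ℕ.* r ℕ.+ k ℕ.* 24 ℕ.* T ℕ.* j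
    expand k = begin-equality
      tn ℕ.* k ℕ.* S
        ≡⟨ cong (tn ℕ.* k ℕ.*_) S≡ ⟩
      tn ℕ.* k ℕ.* (s ℕ.+ suc Q′ ℕ.* 3)
        ≡⟨ regroup tn k s Q′ ⟩
      k ℕ.* (tn ℕ.* (s ℕ.+ 3)) ℕ.+ 3 ℕ.* k ℕ.* (tn ℕ.* Q′)
        ≡⟨ cong (λ z → k ℕ.* (tn ℕ.* (s ℕ.+ 3)) ℕ.+ 3 ℕ.* k ℕ.* z) tnQ′≡ ⟩
      k ℕ.* (tn ℕ.* (s ℕ.+ 3)) ℕ.+ 3 ℕ.* k ℕ.* (r ℕ.+ j ℕ.* (8 ℕ.* T))
        ≡⟨ regroup′ k (tn ℕ.* (s ℕ.+ 3)) r j T ⟩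
      k ℕ.* (tn ℕ.* (s ℕ.+ 3)) ℕ.+ 3 ℕ.* k ℕ.* r ℕ.+ k ℕ.* 24 ℕ.* T ℕ.* j
        ∎
      where
      regroup : ∀ tn k s q →
        tn ℕ.* k ℕ.* (s ℕ.+ suc q ℕ.* 3) ≡ k ℕ.* (tn ℕ.* (s ℕ.+ 3)) ℕ.+ 3 ℕ.* k ℕ.* (tn ℕ.* q)
      regroup = ℕsolve-∀
      regroup′ : ∀ k u r j T →
        k ℕ.* u ℕ.+ 3 ℕ.* k ℕ.* (r ℕ.+ j ℕ.* (8 ℕ.* T)) ≡ k ℕ.* u ℕ.+ 3 ℕ.* k ℕ.* r ℕ.+ k ℕ.* 24 ℕ.* T ℕ.* j
      regroup′ = ℕsolve-∀

    tn[s+3]≤5T : tn ℕ.* (s ℕ.+ 3) ℕ.≤ 5 ℕ.* T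
    tn[s+3]≤5T = begin
      tn ℕ.* (s ℕ.+ 3)  ≤⟨ ℕₚ.*-mono-≤ tn≤T (ℕₚ.+-monoˡ-≤ 3 s≤2) ⟩
      T ℕ.* 5           ≡⟨ ℕₚ.*-comm T 5 ⟩
      5 ℕ.* T           ∎

  x-gap : ℕ.∣ 16 ℕ.* j ℕ.* (T ℕ.* 3) - tn ℕ.* 2 ℕ.* S ∣ ℕ.< 60 ℕ.* T
  x-gap = begin-strict
    ℕ.∣ W - tn ℕ.* 2 ℕ.* S ∣                ≡⟨ cong (λ z → ℕ.∣ W - z ∣) identity ⟩
    ℕ.∣ W - W ℕ.+ D ∣                       ≡⟨ ℕₚ.∣m-m+n∣≡n W D ⟩
    D                                       <⟨ ℕₚ.+-mono-≤-< (ℕₚ.*-monoʳ-≤ 2 tn[s+3]≤5T) (ℕₚ.*-monoʳ-< 6 r<8T) ⟩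
    2 ℕ.* (5 ℕ.* T) ℕ.+ 6 ℕ.* (8 ℕ.* T)     ≡⟨ bound T ⟩
    58 ℕ.* T                                ≤⟨ ℕₚ.*-monoˡ-≤ T (ℕₚ.m≤m+n 58 2) ⟩
    60 ℕ.* T                                ∎
    where
    W = 16 ℕ.* j ℕ.* (T ℕ.* 3)
    D = 2 ℕ.* (tn ℕ.* (s ℕ.+ 3)) ℕ.+ 6 ℕ.* r
    identity : tn ℕ.* 2 ℕ.* S ≡ W ℕ.+ D
    identity = trans (expand 2) (regroup (tn ℕ.* (s ℕ.+ 3)) r j T)
      where
      regroup : ∀ u r j T → 2 ℕ.* u ℕ.+ 3 ℕ.* 2 ℕ.* r ℕ.+ 2 ℕ.* 24 ℕ.* T ℕ.* j
                          ≡ 16 ℕ.* j ℕ.* (T ℕ.* 3) ℕ.+ (2 ℕ.* u ℕ.+ 6 ℕ.* r)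
      regroup = ℕsolve-∀
    bound : ∀ T → 2 ℕ.* (5 ℕ.* T) ℕ.+ 6 ℕ.* (8 ℕ.* T) ≡ 58 ℕ.* T
    bound = ℕsolve-∀

  y-gap : ℕ.∣ tn ℕ.* S - T ℕ.* 3 ℕ.* (4 ℕ.+ 8 ℕ.* j) ∣ ℕ.< 60 ℕ.* T
  y-gap = begin-strict
    ℕ.∣ tn ℕ.* S - m ∣                            ≡⟨ ℕₚ.∣m+n-m+o∣≡∣n-o∣ (12 ℕ.* T) (tn ℕ.* S) m ⟨
    ℕ.∣ 12 ℕ.* T ℕ.+ tn ℕ.* S - 12 ℕ.* T ℕ.+ m ∣  ≡⟨ cong₂ ℕ.∣_-_∣ identity (ℕₚ.+-comm (12 ℕ.* T) m) ⟩
    ℕ.∣ m ℕ.+ D - m ℕ.+ 12 ℕ.* T ∣                ≡⟨ ℕₚ.∣m+n-m+o∣≡∣n-o∣ m D (12 ℕ.* T) ⟩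
    ℕ.∣ D - 12 ℕ.* T ∣                            ≤⟨ ℕₚ.∣m-n∣≤m⊔n D (12 ℕ.* T) ⟩
    D ℕ.⊔ 12 ℕ.* T                                <⟨ ℕₚ.⊔-lub D<60T (ℕₚ.*-monoˡ-< T (ℕₚ.m<m+n 12 {48} (ℕ.s≤s ℕ.z≤n))) ⟩
    60 ℕ.* T                                      ∎
    where
    m = T ℕ.* 3 ℕ.* (4 ℕ.+ 8 ℕ.* j)
    D = tn ℕ.* (s ℕ.+ 3) ℕ.+ 3 ℕ.* r
    identity : 12 ℕ.* T ℕ.+ tn ℕ.* S ≡ m ℕ.+ D
    identity = trans (cong (12 ℕ.* T ℕ.+_) (trans (cong (ℕ._* S) (sym (ℕₚ.*-identityʳ tn))) (expand 1)))
                     (regroup (tn ℕ.* (s ℕ.+ 3)) r j T)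
      where
      regroup : ∀ u r j T → 12 ℕ.* T ℕ.+ (1 ℕ.* u ℕ.+ 3 ℕ.* 1 ℕ.* r ℕ.+ 1 ℕ.* 24 ℕ.* T ℕ.* j)
                          ≡ T ℕ.* 3 ℕ.* (4 ℕ.+ 8 ℕ.* j) ℕ.+ (u ℕ.+ 3 ℕ.* r)
      regroup = ℕsolve-∀
    D<60T : D ℕ.< 60 ℕ.* T
    D<60T = begin-strict
      tn ℕ.* (s ℕ.+ 3) ℕ.+ 3 ℕ.* r  <⟨ ℕₚ.+-mono-≤-< tn[s+3]≤5T (ℕₚ.*-monoʳ-< 3 r<8T) ⟩
      5 ℕ.* T ℕ.+ 3 ℕ.* (8 ℕ.* T)   ≡⟨ bound T ⟩
      29 ℕ.* T                      ≤⟨ ℕₚ.*-monoˡ-≤ T (ℕₚ.m≤m+n 29 31) ⟩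
      60 ℕ.* T                      ∎
      where
      bound : ∀ T → 5 ℕ.* T ℕ.+ 3 ℕ.* (8 ℕ.* T) ≡ 29 ℕ.* T
      bound = ℕsolve-∀

module SegmentApproximation {tn td : ℕ} .{c : Coprime tn (suc td)} (t≤1 : mkℚ (+ tn) td c ℚ.≤ 1ℚ)
                            (M : ℕ) (64≤S : 64 ℕ.≤ 2 ℕ.^ M) where
  private
    t = mkℚ (+ tn) td c
    T = suc td
    S = 2 ℕ.^ M
    instance
      S≢0 : ℕ.NonZero S
      S≢0 = ℕₚ.m^n≢0 2 M

  open Approximation tn td S (numerator≤denominator t≤1) 64≤S public using (j; 4+8j≤S; 16j+2≤2⌊S/3⌋)
  open Approximation tn td S (numerator≤denominator t≤1) 64≤S using (x-gap; y-gap)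

  x′ y′ : ℚ
  x′ = (+ (16 ℕ.* j)) ℚ./ S
  y′ = (+ (S ℕ.∸ (4 ℕ.+ 8 ℕ.* j))) ℚ./ S

  x′-close : ∀ {E e} .{c′ : Coprime (suc E) (suc e)} → 20 ℕ.* suc e ℕ.≤ S →
    ℚ.∣ x′ ℚ.- t ℚ.* ((+ 2) ℚ./ 3) ∣ ℚ.< mkℚ (+ suc E) e c′
  x′-close {E} {e} 20[1+e]≤S =
    ∣p-q∣<-by-fractions (+ (16 ℕ.* j)) (+ tn ℤ.* + 2) S (T ℕ.* 3)
      (toℚᵘ-/ (+ (16 ℕ.* j)) S) (ℚₚ.toℚᵘ-homo-* t ((+ 2) ℚ./ 3))
      (subst (λ N → N ℕ.* suc e ℕ.< suc E ℕ.* (S ℕ.* (T ℕ.* 3))) (sym numerator)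
             (gap-scaled _ T S e E x-gap 20[1+e]≤S))
    where
    numerator : ℤ.∣ + (16 ℕ.* j) ℤ.* + (T ℕ.* 3) ℤ.- (+ tn ℤ.* + 2) ℤ.* + S ∣
              ≡ ℕ.∣ 16 ℕ.* j ℕ.* (T ℕ.* 3) - tn ℕ.* 2 ℕ.* S ∣
    numerator = trans (cong ℤ.∣_∣ (cong₂ ℤ._-_ (sym (ℤₚ.pos-* (16 ℕ.* j) (T ℕ.* 3)))
                  (trans (cong (ℤ._* + S) (sym (ℤₚ.pos-* tn 2))) (sym (ℤₚ.pos-* (tn ℕ.* 2) S)))))
                  (∣+m-+n∣≡∣m-n∣ (16 ℕ.* j ℕ.* (T ℕ.* 3)) (tn ℕ.* 2 ℕ.* S))

  y′-close : ∀ {E e} .{c′ : Coprime (suc E) (suc e)} → 20 ℕ.* suc e ℕ.≤ S →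
    ℚ.∣ y′ ℚ.- (1ℚ ℚ.- t ℚ.* ((+ 1) ℚ./ 3)) ∣ ℚ.< mkℚ (+ suc E) e c′
  y′-close {E} {e} 20[1+e]≤S =
    ∣p-q∣<-by-fractions (+ (S ℕ.∸ m)) b S (1 ℕ.* (T ℕ.* 3))
      (toℚᵘ-/ (+ (S ℕ.∸ m)) S)
      (ℚᵘₚ.≃-trans (ℚₚ.toℚᵘ-homo-+ 1ℚ (ℚ.- (t ℚ.* ((+ 1) ℚ./ 3))))
        (ℚᵘₚ.+-cong ℚᵘₚ.≃-refl (ℚᵘₚ.≃-trans (ℚₚ.toℚᵘ-homo‿- (t ℚ.* ((+ 1) ℚ./ 3)))
                                            (ℚᵘₚ.-‿cong (ℚₚ.toℚᵘ-homo-* t ((+ 1) ℚ./ 3))))))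
      (subst₂ (λ N n → N ℕ.* suc e ℕ.< suc E ℕ.* (S ℕ.* n)) (sym numerator) (sym (ℕₚ.*-identityˡ (T ℕ.* 3)))
              (gap-scaled _ T S e E y-gap 20[1+e]≤S))
    where
    open ≡-Reasoning
    m = 4 ℕ.+ 8 ℕ.* j
    b = + 1 ℤ.* + (T ℕ.* 3) ℤ.+ ℤ.- (+ tn ℤ.* + 1) ℤ.* + 1
    regroup : ∀ S m T3 tn → (S ℤ.- m) ℤ.* T3 ℤ.- (+ 1 ℤ.* T3 ℤ.+ ℤ.- (tn ℤ.* + 1) ℤ.* + 1) ℤ.* S ≡ tn ℤ.* S ℤ.- T3 ℤ.* m
    regroup = ℤsolve-∀
    numerator : ℤ.∣ + (S ℕ.∸ m) ℤ.* + (1 ℕ.* (T ℕ.* 3)) ℤ.- b ℤ.* + S ∣ ≡ ℕ.∣ tn ℕ.* S - T ℕ.* 3 ℕ.* m ∣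
    numerator = begin
      ℤ.∣ + (S ℕ.∸ m) ℤ.* + (1 ℕ.* (T ℕ.* 3)) ℤ.- b ℤ.* + S ∣
        ≡⟨ cong₂ (λ u v → ℤ.∣ u ℤ.* + v ℤ.- b ℤ.* + S ∣)
                 (sym (trans (ℤₚ.m-n≡m⊖n S m) (ℤₚ.⊖-≥ 4+8j≤S))) (ℕₚ.*-identityˡ (T ℕ.* 3)) ⟩
      ℤ.∣ (+ S ℤ.- + m) ℤ.* + (T ℕ.* 3) ℤ.- b ℤ.* + S ∣
        ≡⟨ cong ℤ.∣_∣ (regroup (+ S) (+ m) (+ (T ℕ.* 3)) (+ tn)) ⟩
      ℤ.∣ + tn ℤ.* + S ℤ.- + (T ℕ.* 3) ℤ.* + m ∣
        ≡⟨ cong₂ (λ u v → ℤ.∣ u ℤ.- v ∣) (ℤₚ.pos-* tn S) (ℤₚ.pos-* (T ℕ.* 3) m) ⟨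
      ℤ.∣ + (tn ℕ.* S) ℤ.- + (T ℕ.* 3 ℕ.* m) ∣
        ≡⟨ ∣+m-+n∣≡∣m-n∣ (tn ℕ.* S) (T ℕ.* 3 ℕ.* m) ⟩
      ℕ.∣ tn ℕ.* S - T ℕ.* 3 ℕ.* m ∣
        ∎

mainTheorem12 : (t : ℚ) → 0ℚ ≤ t → t ≤ 1ℚ →
    InClosureX Γ 2 (t * ((+ 2) / 3)) (1ℚ - t * ((+ 1) / 3))
mainTheorem12 (mkℚ -[1+ _ ] _ _) (ℚ.*≤* ()) _
mainTheorem12 (mkℚ (+ _) _ _) _ _ (mkℚ -[1+ _ ] _ _) (ℚ.*<* ())
mainTheorem12 (mkℚ (+ _) _ _) _ _ (mkℚ (+ 0) _ _) (ℚ.*<* (ℤ.+<+ ()))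
mainTheorem12 (mkℚ (+ tn) td c) _ t≤1 (mkℚ (+ suc E) e _) _ =
  x′ , y′ , X-point M j 4+8j≤S 16j+2≤2⌊S/3⌋ , x′-close 20[1+e]≤S , y′-close 20[1+e]≤S
  where
  M = suc e ℕ.+ 6
  open SegmentApproximation {c = c} t≤1 M (proj₁ (2^[k+6]-bounds (suc e)))
  20[1+e]≤S = proj₂ (2^[k+6]-bounds (suc e))
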